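{- Say a graph $H$ satisfies AVD-TCC if $\chi''_a(H)\leq\Delta(H)+3$. Then: (1) If $G_1,G_2$ are graphs such that $C(G_1)$ and $C(G_2)$ satisfy AVD-TCC, then $C(G_1+G_2)$ satisfies AVD-TCC. (2) $C(K_{m,n})$ satisfies AVD-TCC for all $m,n\geq 2$. (3) If $G_1,G_2\in\{P_n,C_n,K_n\}$, then $C(G_1+G_2)$ satisfies AVD-TCC, for any integer $n\geq 2$ for which these graphs are defined. (4) If $G_1$ and $G_2$ have the same order, then $C(G_1+G_2)$ satisfies AVD-TCC.
   Context: All graphs are simple, finite, undirected. $P_n$, $C_n$ ($n\ge 3$), $K_n$ are the path, cycle and complete graph on $n$ vertices, $K_{m,n}$ the complete bipartite graph. $G_1+G_2$ is the join: the disjoint union of $G_1$ and $G_2$ together with all edges between a vertex of $G_1$ and a vertex of $G_2$. The central graph $C(G)$ has vertex set $V(G)\cup\{w_{u,v}:\{u,v\}\in E(G)\}$ and edge set consisting of all pairs of distinct non-adjacent vertices of $G$, together with $\{u,w_{u,v}\}$ and $\{w_{u,v},v\}$ for every $\{u,v\}\in E(G)$. $\Delta(H)$ is the maximum degree. A proper total coloring $f$ colors vertices and edges so that adjacent vertices, adjacent edges, and incident vertex-edge pairs get different colors; the color class of $u$ is $C_H(u)=\{f(u)\}\cup\{f(\{u,v\}):\{u,v\}\in E(H)\}$; an AVD-total coloring is a proper total coloring with $C_H(u)\neq C_H(v)$ for every edge $\{u,v\}$; $\chi''_a(H)$ is the least number of colors in an AVD-total coloring of $H$. -}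

module Defs where

open import Data.Bool using (Bool; true; false; not; _∧_; _∨_; if_then_else_)
open import Data.Bool.Properties using (∨-comm)
open import Data.Nat using (ℕ; zero; suc; _+_; _∸_; _⊔_; _≡ᵇ_; _≤ᵇ_; _≤_)
open import Data.Fin using (Fin; toℕ; splitAt)
open import Data.Fin.Properties using () renaming (_≟_ to _≟ᶠ_)
open import Data.List using (List; []; _∷_; concatMap; allFin; map; foldr; length; lookup)
open import Data.Nat.ListAction using (sum)
open import Data.Product using (_×_; _,_; Σ)
open import Data.Sum using (_⊎_; inj₁; inj₂)
open import Relation.Nullary using (¬_; yes; no)
open import Relation.Nullary.Decidable using (⌊_⌋)
open import Relation.Binary.PropositionalEquality using (_≡_; _≢_; refl; cong₂)
open import Function.Bundles using (_⇔_)

record Graph (n : ℕ) : Set where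
  field
    adj    : Fin n → Fin n → Bool
    sym    : ∀ u v → adj u v ≡ adj v u
    irrefl : ∀ u → adj u u ≡ false
open Graph public

Adj : ∀ {n} → Graph n → Fin n → Fin n → Set
Adj G u v = adj G u v ≡ true

eqᵇ : ∀ {n} → Fin n → Fin n → Bool
eqᵇ u v = ⌊ u ≟ᶠ v ⌋

eqᵇ-sym : ∀ {n} (u v : Fin n) → eqᵇ u v ≡ eqᵇ v u
eqᵇ-sym u v with u ≟ᶠ v | v ≟ᶠ u
... | yes _ | yes _ = refl
... | no _  | no _  = refl
... | yes refl | no q = Data.Empty.⊥-elim (q refl) where import Data.Empty
... | no p  | yes refl = Data.Empty.⊥-elim (p refl) where import Data.Empty

eqᵇ-refl : ∀ {n} (u : Fin n) → eqᵇ u u ≡ true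
eqᵇ-refl u with u ≟ᶠ u
... | yes _ = refl
... | no p  = Data.Empty.⊥-elim (p refl) where import Data.Empty

mkGraph : ∀ {n} → (Fin n → Fin n → Bool) → Graph n
mkGraph r = record
  { adj    = λ u v → not (eqᵇ u v) ∧ (r u v ∨ r v u)
  ; sym    = λ u v → cong₂ (λ a b → not a ∧ b) (eqᵇ-sym u v) (∨-comm (r u v) (r v u))
  ; irrefl = λ u → helper (eqᵇ u u) (eqᵇ-refl u) }
  where
  helper : ∀ (b : Bool) {c} → b ≡ true → not b ∧ c ≡ false
  helper .true refl = refl

deg : ∀ {n} → Graph n → Fin n → ℕ
deg {n} G u = sum (map (λ v → if adj G u v then 1 else 0) (allFin n))

Δ : ∀ {n} → Graph n → ℕ
Δ {n} G = foldr _⊔_ 0 (map (deg G) (allFin n))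

P : (n : ℕ) → Graph n
P n = mkGraph (λ i j → suc (toℕ i) ≡ᵇ toℕ j)

-- cycle C_n (meant for n ≥ 3) : i ~ i+1 and (n-1) ~ 0
C : (n : ℕ) → Graph n
C n = mkGraph (λ i j → (suc (toℕ i) ≡ᵇ toℕ j)
                       ∨ ((3 ≤ᵇ n) ∧ (toℕ i ≡ᵇ (n ∸ 1)) ∧ (toℕ j ≡ᵇ 0)))

K : (n : ℕ) → Graph n
K n = mkGraph (λ _ _ → true)

isLeft : ∀ {a b} {A : Set a} {B : Set b} → A ⊎ B → Bool
isLeft (inj₁ _) = true
isLeft (inj₂ _) = false

-- complete bipartite graph K_{m,n}: parts Fin m (first m vertices) and Fin n
Kbip : (m n : ℕ) → Graph (m + n)
Kbip m n = mkGraph (λ x y → isLeft (splitAt m x) ∧ not (isLeft (splitAt m y)))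

-- Join G₁ + G₂ on Fin (n₁ + n₂): first n₁ vertices are G₁, rest G₂.

joinRel : ∀ {n₁ n₂} → Graph n₁ → Graph n₂ →
          Fin n₁ ⊎ Fin n₂ → Fin n₁ ⊎ Fin n₂ → Bool
joinRel G₁ G₂ (inj₁ u) (inj₁ v) = adj G₁ u v
joinRel G₁ G₂ (inj₂ u) (inj₂ v) = adj G₂ u v
joinRel G₁ G₂ (inj₁ u) (inj₂ v) = true
joinRel G₁ G₂ (inj₂ u) (inj₁ v) = false

join : ∀ {n₁ n₂} → Graph n₁ → Graph n₂ → Graph (n₁ + n₂)
join {n₁} G₁ G₂ = mkGraph (λ x y → joinRel G₁ G₂ (splitAt n₁ x) (splitAt n₁ y))

edges : ∀ {n} → Graph n → List (Fin n × Fin n)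
edges {n} G = concatMap (λ u → concatMap (λ v →
                if adj G u v ∧ (suc (toℕ u) ≤ᵇ toℕ v) then (u , v) ∷ [] else [])
              (allFin n)) (allFin n)

nE : ∀ {n} → Graph n → ℕ
nE G = length (edges G)

edge : ∀ {n} (G : Graph n) → Fin (nE G) → Fin n × Fin n
edge G = lookup (edges G)

endpoint : ∀ {n} → Fin n → Fin n × Fin n → Bool
endpoint u (a , b) = eqᵇ u a ∨ eqᵇ u b

centralRel : ∀ {n} (G : Graph n) →
             Fin n ⊎ Fin (nE G) → Fin n ⊎ Fin (nE G) → Bool
centralRel G (inj₁ u) (inj₁ v) = not (adj G u v)
centralRel G (inj₁ u) (inj₂ e) = endpoint u (edge G e)
centralRel G (inj₂ e) (inj₁ u) = false
centralRel G (inj₂ e) (inj₂ f) = false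

-- vertices: Fin n are the original vertices, the remaining nE G are the w_{u,v}
central : ∀ {n} (G : Graph n) → Graph (n + nE G)
central {n} G = mkGraph (λ x y → centralRel G (splitAt n x) (splitAt n y))

record AVDTotalColoring {n} (G : Graph n) (k : ℕ) : Set where
  field
    vcol : Fin n → Fin k
    ecol : Fin n → Fin n → Fin k         -- colour of edge {u,v} (only meaningful if u ~ v)
    ecol-sym  : ∀ u v → Adj G u v → ecol u v ≡ ecol v u
    vproper   : ∀ u v → Adj G u v → vcol u ≢ vcol v
    eproper   : ∀ u v w → Adj G u v → Adj G u w → v ≢ w → ecol u v ≢ ecol u w
    incproper : ∀ u v → Adj G u v → vcol u ≢ ecol u v
  InClass : Fin n → Fin k → Set
  InClass u c = (vcol u ≡ c) ⊎ Σ (Fin n) (λ v → Adj G u v × (ecol u v ≡ c))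
  field
    avd : ∀ u v → Adj G u v → ¬ (∀ c → InClass u c ⇔ InClass v c)

χa≤ : ∀ {n} → Graph n → ℕ → Set
χa≤ G k = AVDTotalColoring G k

AVD-TCC : ∀ {n} → Graph n → Set
AVD-TCC H = χa≤ H (Δ H + 3)

data Family : Set where
  path cycle complete : Family

famGraph : Family → (n : ℕ) → Graph n
famGraph path     n = P n
famGraph cycle    n = C n
famGraph complete n = K n

DefinedAt : Family → ℕ → Set
DefinedAt path     n = 2 ≤ n
DefinedAt cycle    n = 3 ≤ n
DefinedAt complete n = 2 ≤ n

{-# OPTIONS --safe #-}
-- C(G) is the complete graph on V(G) with every edge of G subdivided. Fix an
-- order pos : V(G) → {0, …, N-1} and the odd q ∈ {N+1, N+2}. As in the
-- classical total coloring of K_N, vertex v gets pos v + pos v and the edge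
-- from v towards k gets pos v + slot v k (both mod q), where slot v k = pos k,
-- except that the lower neighbours of v in G are rotated: each one is sent to
-- the next lower neighbour, the last one to N + 1. Then slot v is injective,
-- it misses N and spare v (the position of the first lower neighbour of v, or
-- N + 1 if there is none), and the two halves of a subdivided edge differ.
-- If pos u < pos v, then pos u + N is missing at u, and it is present at v as
-- soon as the vertex at position 0 is adjacent to the second half of the
-- order; the join of two non-empty graphs has such an order (smaller side
-- first). A subdivision vertex gets one of the colors 0, …, 4 or a color
-- missing at its lower end. All colors are below max(N + 2, 5) ≤ Δ(C(G)) + 3.
-- K_{m,n} is the join of two edgeless graphs, and a join with an empty graph
-- is the other graph.
module Submission where

open import Defs hiding (sym)
open import Data.Nat
open import Data.Nat.Properties
open import Data.Nat.ListAction using (sum)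
open import Data.Nat.Tactic.RingSolver using (solve-∀)
open import Data.Bool using (Bool; true; false; not; _∧_; _∨_; if_then_else_; T)
open import Data.Bool.Properties using (∨-zeroʳ; ∨-idem; ∧-zeroʳ; ∧-conicalˡ; ∧-conicalʳ; T-≡)
import Data.Bool.Properties as Bool
open import Data.Product using (Σ; ∃; _×_; _,_; proj₁; proj₂)
open import Data.Sum using (_⊎_; inj₁; inj₂; [_,_]′)
open import Data.Sum.Properties using (inj₁-injective)
open import Data.Empty using (⊥-elim)
open import Data.List using (List; []; _∷_; length; lookup; map; foldr; allFin; concatMap; filter; filterᵇ)
open import Data.List.Properties using (map-cong; concatMap-cong)
open import Data.List.Membership.Propositional using (_∈_; _∉_; lose)
open import Data.List.Membership.Propositional.Properties using (∈-allFin; ∈-map⁺; ∈-map⁻; ∈-lookup)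
open import Data.List.Membership.Propositional.Properties using (∈-concatMap⁻; ∈-concatMap⁺; ∈-filter⁺; ∈-filter⁻)
open import Data.List.Membership.DecPropositional _≟_ using (_∈?_)
open import Data.List.Relation.Unary.Any using (here; there; index; satisfied)
open import Data.List.Relation.Unary.Any.Properties using (lookup-index)
open import Data.List.Relation.Unary.All using ([]; _∷_)
import Data.List.Relation.Unary.All as All
import Data.List.Relation.Unary.All.Properties as All
open import Data.List.Relation.Unary.AllPairs using ([]; _∷_)
import Data.List.Relation.Unary.AllPairs as AllPairs
import Data.List.Relation.Unary.AllPairs.Properties as AllPairs
open import Data.List.Relation.Unary.Unique.Propositional using (Unique)
import Data.List.Relation.Unary.Unique.Propositional.Properties as Unique
open import Data.List.Relation.Binary.Disjoint.Propositional using (Disjoint)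
open import Data.List.Extrema ≤-totalOrder using (min; min≤⊤; min≤v⁺; argmin-sel; argmax; argmax-all; f[xs]≤f[argmax])
open import Data.Fin using (Fin; toℕ; zero; suc; fromℕ<; splitAt; cast; _↑ˡ_; opposite)
import Data.Fin as Fin
open import Data.Fin.Properties using (any?; toℕ<n; toℕ-injective; injective⇒≤; toℕ-fromℕ<; fromℕ<-cong; fromℕ<-injective)
open import Data.Fin.Properties using (+↔⊎; splitAt-join; join-splitAt; splitAt-<; splitAt-≥; toℕ-cast; cast-is-id; toℕ-↑ˡ)
open import Data.Fin.Properties using (opposite-prop; opposite-involutive) renaming (_≟_ to _≟ᶠ_; suc-injective to Fin-suc-injective)
open import Data.Fin.Permutation using (Permutation′; _⟨$⟩ʳ_; _⟨$⟩ˡ_; inverseˡ; inverseʳ; reverse) renaming (id to identity)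
open import Function.Base using (_∘_)
open import Function.Bundles using (_⇔_; _↔_; Inverse; Equivalence; mk⇔)
open import Relation.Nullary using (Dec; yes; no; ¬_; ¬?)
open import Relation.Nullary.Decidable using (T?; _×-dec_)
open import Relation.Binary using (tri<; tri≈; tri>)
open import Relation.Binary.PropositionalEquality

-- reduce n ≡ n mod q whenever n < q + q.
module ReduceOnce (q : ℕ) where

  reduce : ℕ → ℕ
  reduce n with n <? q
  ... | yes _ = n
  ... | no  _ = n ∸ q

  reduce-cases : ∀ n → (n < q × reduce n ≡ n) ⊎ (q ≤ n × reduce n + q ≡ n)
  reduce-cases n with n <? q
  ... | yes n<q = inj₁ (n<q , refl)
  ... | no  n≮q = inj₂ (≮⇒≥ n≮q , m∸n+n≡m (≮⇒≥ n≮q))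

  reduce< : ∀ {n} → n < q + q → reduce n < q
  reduce< {n} n<2q with reduce-cases n
  ... | inj₁ (n<q , eq) = subst (_< q) (sym eq) n<q
  ... | inj₂ (_ , eq)   = +-cancelʳ-< q (reduce n) q (subst (_< q + q) (sym eq) n<2q)

  reduce-injective : ∀ {m n} → reduce m ≡ reduce n → m ≡ n ⊎ m + q ≡ n ⊎ n + q ≡ m
  reduce-injective {m} {n} eq with reduce-cases m | reduce-cases n
  ... | inj₁ (_ , em) | inj₁ (_ , en) = inj₁ (trans (sym em) (trans eq en))
  ... | inj₁ (_ , em) | inj₂ (_ , en) = inj₂ (inj₁ (trans (cong (_+ q) (trans (sym em) eq)) en))
  ... | inj₂ (_ , em) | inj₁ (_ , en) = inj₂ (inj₂ (trans (cong (_+ q) (trans (sym en) (sym eq))) em))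
  ... | inj₂ (_ , em) | inj₂ (_ , en) = inj₁ (trans (sym em) (trans (cong (_+ q) eq) en))

  private
    +q≢ : ∀ a {s t} → t < q → a + s + q ≢ a + t
    +q≢ a {s} {t} t<q e =
      <⇒≱ t<q (subst (q ≤_) (+-cancelˡ-≡ a (s + q) t (trans (sym (+-assoc a s q)) e)) (m≤n+m q s))

  reduce-+-injectiveʳ : ∀ a {s t} → s < q → t < q → reduce (a + s) ≡ reduce (a + t) → s ≡ t
  reduce-+-injectiveʳ a {s} {t} s<q t<q eq with reduce-injective eq
  ... | inj₁ e        = +-cancelˡ-≡ a s t e
  ... | inj₂ (inj₁ e) = ⊥-elim (+q≢ a t<q e)
  ... | inj₂ (inj₂ e) = ⊥-elim (+q≢ a s<q e)

  private
    double-injective : ∀ {a b} → a + a ≡ b + b → a ≡ b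
    double-injective {a} {b} e = *-cancelˡ-≡ a b 2 (begin
      2 * a ≡⟨ cong (a +_) (+-identityʳ a) ⟩
      a + a ≡⟨ e ⟩
      b + b ≡⟨ cong (b +_) (sym (+-identityʳ b)) ⟩
      2 * b ∎)
      where open ≡-Reasoning

    double+odd≢double : ∀ k → q ≡ suc (2 * k) → ∀ {a b} → a + a + q ≢ b + b
    double+odd≢double k q≡ {a} {b} e = even≢odd b (a + k) (begin
      2 * b               ≡⟨ cong (b +_) (+-identityʳ b) ⟩
      b + b               ≡⟨ sym e ⟩
      a + a + q           ≡⟨ cong (a + a +_) q≡ ⟩
      a + a + suc (2 * k) ≡⟨ regroup a k ⟩
      suc (2 * (a + k))   ∎)
      where
      open ≡-Reasoning
      regroup : ∀ a k → a + a + suc (2 * k) ≡ suc (2 * (a + k))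
      regroup = solve-∀

  reduce-double-injective : ∀ k → q ≡ suc (2 * k) → ∀ {a b} → reduce (a + a) ≡ reduce (b + b) → a ≡ b
  reduce-double-injective k q≡ {a} {b} eq with reduce-injective eq
  ... | inj₁ e        = double-injective e
  ... | inj₂ (inj₁ e) = ⊥-elim (double+odd≢double k q≡ {a} {b} e)
  ... | inj₂ (inj₂ e) = ⊥-elim (double+odd≢double k q≡ {b} {a} e)

odd-between : ∀ N → ∃ λ k → N < suc (2 * k) × suc (2 * k) ≤ 2 + N
odd-between zero = 0 , s≤s z≤n , s≤s z≤n
odd-between (suc N) with odd-between N
... | k , N<q , q≤2+N with suc N <? suc (2 * k)
...   | yes 1+N<q = k , 1+N<q , m≤n⇒m≤1+n q≤2+N
...   | no  1+N≮q = suc k , subst (suc N <_) 3+2k≡ (s≤s (m≤n⇒m≤1+n N<q))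
                          , subst (_≤ 3 + N) 3+2k≡ (s≤s (s≤s (s≤s (≤-pred (≮⇒≥ 1+N≮q)))))
  where
  3+2k≡ : 3 + 2 * k ≡ suc (2 * suc k)
  3+2k≡ = cong suc (sym (*-suc 2 k))

∃∉-≤-length : (xs : List ℕ) → ∃ λ c → c ≤ length xs × c ∉ xs
∃∉-≤-length xs with any? (λ (i : Fin (suc (length xs))) → ¬? (toℕ i ∈? xs))
... | yes (i , i∉xs) = toℕ i , ≤-pred (toℕ<n i) , i∉xs
... | no  none       = ⊥-elim (<-irrefl refl (injective⇒≤ position-injective))
  where
  member : ∀ i → toℕ i ∈ xs
  member i with toℕ i ∈? xs
  ... | yes i∈xs = i∈xs
  ... | no  i∉xs = ⊥-elim (none (i , i∉xs))
  position-injective : ∀ {i j} → index (member i) ≡ index (member j) → i ≡ j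
  position-injective {i} {j} eq =
    toℕ-injective (trans (lookup-index (member i)) (trans (cong (lookup xs) eq) (sym (lookup-index (member j)))))

Adj-sym : ∀ {n} (G : Graph n) {u v} → Adj G u v → Adj G v u
Adj-sym G {u} {v} = trans (Graph.sym G v u)

Adj⇒≢ : ∀ {n} (G : Graph n) {u v} → Adj G u v → u ≢ v
Adj⇒≢ G {u} u~u refl with () ← trans (sym (irrefl G u)) u~u

eqᵇ-≢ : ∀ {n} {x y : Fin n} → x ≢ y → eqᵇ x y ≡ false
eqᵇ-≢ {x = x} {y} x≢y with x ≟ᶠ y
... | yes x≡y = ⊥-elim (x≢y x≡y)
... | no  _   = refl

eqᵇ⇒≡ : ∀ {n} {x y : Fin n} → eqᵇ x y ≡ true → x ≡ y
eqᵇ⇒≡ {x = x} {y} eq with x ≟ᶠ y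
... | yes x≡y = x≡y

module _ {n} (r : Fin n → Fin n → Bool) where

  Adj-mkGraph⁺ : ∀ {x y} → x ≢ y → r x y ≡ true ⊎ r y x ≡ true → Adj (mkGraph r) x y
  Adj-mkGraph⁺ {x} {y} x≢y rxy rewrite eqᵇ-≢ x≢y with rxy
  ... | inj₁ e = cong (_∨ r y x) e
  ... | inj₂ e = trans (cong (r x y ∨_) e) (∨-zeroʳ (r x y))

  Adj-mkGraph⁻ : ∀ {x y} → Adj (mkGraph r) x y → x ≢ y × (r x y ≡ true ⊎ r y x ≡ true)
  Adj-mkGraph⁻ {x} {y} x~y = Adj⇒≢ (mkGraph r) x~y , ∨-true⁻ (∧-conicalʳ (not (eqᵇ x y)) _ x~y)
    where
    ∨-true⁻ : ∀ {a b} → a ∨ b ≡ true → a ≡ true ⊎ b ≡ true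
    ∨-true⁻ {true}  _ = inj₁ refl
    ∨-true⁻ {false} e = inj₂ e

mkGraph-cong : ∀ {n} {r r′ : Fin n → Fin n → Bool} → (∀ x y → r x y ≡ r′ x y) →
               ∀ x y → adj (mkGraph r) x y ≡ adj (mkGraph r′) x y
mkGraph-cong r≗r′ x y = cong₂ (λ a b → not (eqᵇ x y) ∧ (a ∨ b)) (r≗r′ x y) (r≗r′ y x)

mkGraph-induced : ∀ {m n} (G : Graph m) (f : Fin n → Fin m) →
                  ∀ x y → adj (mkGraph (λ x y → adj G (f x) (f y))) x y ≡ adj G (f x) (f y)
mkGraph-induced G f x y with x ≟ᶠ y
... | yes refl = sym (irrefl G (f x))
... | no  _    = trans (cong (adj G (f x) (f y) ∨_) (Graph.sym G (f y) (f x))) (∨-idem _)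

deg≤Δ : ∀ {n} (H : Graph n) x → deg H x ≤ Δ H
deg≤Δ {n} H x = ≤-foldr-⊔ (∈-map⁺ (deg H) (∈-allFin x))
  where
  ≤-foldr-⊔ : ∀ {xs m} → m ∈ xs → m ≤ foldr _⊔_ 0 xs
  ≤-foldr-⊔ {y ∷ ys} (here refl) = m≤m⊔n y _
  ≤-foldr-⊔ {y ∷ ys} (there m∈) = ≤-trans (≤-foldr-⊔ m∈) (m≤n⊔m y _)

≤-deg : ∀ {n m} (H : Graph n) x (g : Fin m → Fin n) →
        (∀ {i j} → g i ≡ g j → i ≡ j) → (∀ i → Adj H x (g i)) → m ≤ deg H x
≤-deg {n} {m} H x g g-injective x~g =
  subst (m ≤_) (length-filterᵇ (allFin n)) (injective⇒≤ position-injective)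
  where
  neighbours : List (Fin n)
  neighbours = filterᵇ (adj H x) (allFin n)
  length-filterᵇ : ∀ vs → length (filterᵇ (adj H x) vs) ≡ sum (map (λ v → if adj H x v then 1 else 0) vs)
  length-filterᵇ []       = refl
  length-filterᵇ (v ∷ vs) with adj H x v
  ... | true  = cong suc (length-filterᵇ vs)
  ... | false = length-filterᵇ vs
  member : ∀ i → g i ∈ neighbours
  member i = ∈-filter⁺ {P = λ v → T (adj H x v)} (λ v → T? (adj H x v)) (∈-allFin (g i)) (Equivalence.from T-≡ (x~g i))
  position-injective : ∀ {i j} → index (member i) ≡ index (member j) → i ≡ j
  position-injective {i} {j} eq =
    g-injective (trans (lookup-index (member i)) (trans (cong (lookup neighbours) eq) (sym (lookup-index (member j)))))

lookup-injective : ∀ {A : Set} {xs : List A} → Unique xs → ∀ {i j} → lookup xs i ≡ lookup xs j → i ≡ j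
lookup-injective {xs = _ ∷ xs} (x∉ ∷ _) {zero}  {zero}  _  = refl
lookup-injective {xs = _ ∷ xs} (x∉ ∷ _) {zero}  {suc j} eq = ⊥-elim (All.lookup x∉ (∈-lookup {xs = xs} j) eq)
lookup-injective {xs = _ ∷ xs} (x∉ ∷ _) {suc i} {zero}  eq = ⊥-elim (All.lookup x∉ (∈-lookup {xs = xs} i) (sym eq))
lookup-injective {xs = _ ∷ xs} (_ ∷ u)  {suc i} {suc j} eq = cong suc (lookup-injective u eq)

module _ {n} (G : Graph n) where

  private
    candidate : Fin n → Fin n → List (Fin n × Fin n)
    candidate u v = if adj G u v ∧ (suc (toℕ u) ≤ᵇ toℕ v) then (u , v) ∷ [] else []

    row : Fin n → List (Fin n × Fin n)
    row u = concatMap (candidate u) (allFin n)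

    ∈-candidate⁻ : ∀ {u v p} → p ∈ candidate u v → p ≡ (u , v) × adj G u v ∧ (suc (toℕ u) ≤ᵇ toℕ v) ≡ true
    ∈-candidate⁻ {u} {v} p∈ with adj G u v ∧ (suc (toℕ u) ≤ᵇ toℕ v)
    ∈-candidate⁻ (here refl) | true = refl , refl

    ∈-row⁻ : ∀ {u p} → p ∈ row u → proj₁ p ≡ u
    ∈-row⁻ {u} p∈ with satisfied (∈-concatMap⁻ (candidate u) {xs = allFin n} p∈)
    ... | v , p∈′ = cong proj₁ (proj₁ (∈-candidate⁻ p∈′))

    candidate-unique : ∀ u v → Unique (candidate u v)
    candidate-unique u v with adj G u v ∧ (suc (toℕ u) ≤ᵇ toℕ v)
    ... | true  = [] ∷ []
    ... | false = []

    row-unique : ∀ u → Unique (row u)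
    row-unique u = Unique.concat⁺ (All.map⁺ (All.tabulate⁺ (candidate-unique u)))
                     (AllPairs.map⁺ (AllPairs.map disjoint (Unique.allFin⁺ n)))
      where
      disjoint : ∀ {v v′} → v ≢ v′ → Disjoint (candidate u v) (candidate u v′)
      disjoint v≢v′ (p∈ , p∈′) = v≢v′ (trans (sym (cong proj₂ (proj₁ (∈-candidate⁻ p∈))))
                                             (cong proj₂ (proj₁ (∈-candidate⁻ p∈′))))

  ∈-edges⁻ : ∀ {p} → p ∈ edges G → Adj G (proj₁ p) (proj₂ p) × toℕ (proj₁ p) < toℕ (proj₂ p)
  ∈-edges⁻ p∈ with satisfied (∈-concatMap⁻ row {xs = allFin n} p∈)
  ... | u , p∈row with satisfied (∈-concatMap⁻ (candidate u) {xs = allFin n} p∈row)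
  ... | v , p∈cand with ∈-candidate⁻ p∈cand
  ... | refl , c = ∧-conicalˡ _ _ c , ≤ᵇ⇒≤ _ _ (Equivalence.from T-≡ (∧-conicalʳ _ _ c))

  ∈-edges⁺ : ∀ {a b} → Adj G a b → toℕ a < toℕ b → (a , b) ∈ edges G
  ∈-edges⁺ {a} {b} a~b a<b =
    ∈-concatMap⁺ row (lose (∈-allFin a) (∈-concatMap⁺ (candidate a) (lose (∈-allFin b) ∈cand)))
    where
    ∈cand : (a , b) ∈ candidate a b
    ∈cand rewrite a~b | Equivalence.to T-≡ (≤⇒≤ᵇ a<b) = here refl

  edges-unique : Unique (edges G)
  edges-unique = Unique.concat⁺ (All.map⁺ (All.tabulate⁺ row-unique))
                   (AllPairs.map⁺ (AllPairs.map disjoint (Unique.allFin⁺ n)))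
    where
    disjoint : ∀ {u u′} → u ≢ u′ → Disjoint (row u) (row u′)
    disjoint u≢u′ (p∈ , p∈′) = u≢u′ (trans (sym (∈-row⁻ p∈)) (∈-row⁻ p∈′))

  edge-Adj : ∀ e → Adj G (proj₁ (edge G e)) (proj₂ (edge G e))
  edge-Adj e = proj₁ (∈-edges⁻ (∈-lookup {xs = edges G} e))

  edge-< : ∀ e → toℕ (proj₁ (edge G e)) < toℕ (proj₂ (edge G e))
  edge-< e = proj₂ (∈-edges⁻ (∈-lookup {xs = edges G} e))

  edge-injective : ∀ {e e′} → edge G e ≡ edge G e′ → e ≡ e′
  edge-injective = lookup-injective edges-unique

  edge-index : ∀ {a b} → Adj G a b → toℕ a < toℕ b → ∃ λ e → edge G e ≡ (a , b)
  edge-index {a} {b} a~b a<b = index ∈e , sym (lookup-index ∈e)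
    where
    ∈e : (a , b) ∈ edges G
    ∈e = ∈-edges⁺ a~b a<b

  Incident : Fin n → Fin (nE G) → Set
  Incident u e = endpoint u (edge G e) ≡ true

  other : Fin n → Fin n × Fin n → Fin n
  other u (a , b) = if eqᵇ u a then b else a

  private
    endpoint-other : ∀ {u a b} → eqᵇ u a ∨ eqᵇ u b ≡ true →
                     (a , b) ≡ (u , other u (a , b)) ⊎ (a , b) ≡ (other u (a , b) , u)
    endpoint-other {u} {a} {b} u∈ab with eqᵇ u a in u≟a
    ... | true  = inj₁ (cong (_, b) (sym (eqᵇ⇒≡ u≟a)))
    ... | false = inj₂ (cong (a ,_) (sym (eqᵇ⇒≡ u∈ab)))

  incident-edge : ∀ {u e} → Incident u e →
                  edge G e ≡ (u , other u (edge G e)) ⊎ edge G e ≡ (other u (edge G e) , u)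
  incident-edge {e = e} = endpoint-other {a = proj₁ (edge G e)} {b = proj₂ (edge G e)}

  Adj-other : ∀ {u e} → Incident u e → Adj G u (other u (edge G e))
  Adj-other {u} {e} u∈e with incident-edge u∈e
  ... | inj₁ eq = subst (λ p → Adj G (proj₁ p) (proj₂ p)) eq (edge-Adj e)
  ... | inj₂ eq = Adj-sym G (subst (λ p → Adj G (proj₁ p) (proj₂ p)) eq (edge-Adj e))

  private
    edge-ordered : ∀ {e a b} → edge G e ≡ (a , b) → toℕ a < toℕ b
    edge-ordered {e} eq = subst (λ p → toℕ (proj₁ p) < toℕ (proj₂ p)) eq (edge-< e)

  other-injective : ∀ {u e e′} → Incident u e → Incident u e′ →
                    other u (edge G e) ≡ other u (edge G e′) → e ≡ e′
  other-injective {u} {e} {e′} u∈e u∈e′ eq with incident-edge u∈e | incident-edge u∈e′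
  ... | inj₁ p | inj₁ p′ = edge-injective (trans p (trans (cong (u ,_) eq) (sym p′)))
  ... | inj₂ p | inj₂ p′ = edge-injective (trans p (trans (cong (_, u) eq) (sym p′)))
  ... | inj₁ p | inj₂ p′ =
    ⊥-elim (<-asym (edge-ordered p) (subst (λ w → toℕ w < toℕ u) (sym eq) (edge-ordered p′)))
  ... | inj₂ p | inj₁ p′ =
    ⊥-elim (<-asym (edge-ordered p) (subst (λ w → toℕ u < toℕ w) (sym eq) (edge-ordered p′)))

  private
    fst-endpoint : ∀ (a b : Fin n) → endpoint a (a , b) ≡ true × other a (a , b) ≡ b
    fst-endpoint a b rewrite eqᵇ-refl a = refl , refl

    snd-endpoint : ∀ {a b : Fin n} → a ≢ b → endpoint b (a , b) ≡ true × other b (a , b) ≡ a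
    snd-endpoint {a} {b} a≢b rewrite eqᵇ-≢ (λ b≡a → a≢b (sym b≡a)) | eqᵇ-refl b = refl , refl

  fst-incident : ∀ e → Incident (proj₁ (edge G e)) e × other (proj₁ (edge G e)) (edge G e) ≡ proj₂ (edge G e)
  fst-incident e = fst-endpoint (proj₁ (edge G e)) (proj₂ (edge G e))

  snd-incident : ∀ e → Incident (proj₂ (edge G e)) e × other (proj₂ (edge G e)) (edge G e) ≡ proj₁ (edge G e)
  snd-incident e = snd-endpoint (Adj⇒≢ G (edge-Adj e))

  edge-between : ∀ {u v} → Adj G u v → ∃ λ e → Incident u e × other u (edge G e) ≡ v
  edge-between {u} {v} u~v with <-cmp (toℕ u) (toℕ v)
  ... | tri< u<v _ _ = let e , e≡ = edge-index u~v u<v in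
    e , subst (λ p → endpoint u p ≡ true × other u p ≡ v) (sym e≡) (fst-endpoint u v)
  ... | tri≈ _ u≡v _ = ⊥-elim (Adj⇒≢ G u~v (toℕ-injective u≡v))
  ... | tri> _ _ v<u = let e , e≡ = edge-index (Adj-sym G u~v) v<u in
    e , subst (λ p → endpoint u p ≡ true × other u p ≡ v) (sym e≡) (snd-endpoint (Adj⇒≢ G (Adj-sym G u~v)))

module _ {A : Set} (_~_ : A → A → Set) (vcol : A → ℕ) (ecol : A → A → ℕ) where

  ColorClass : A → ℕ → Set
  ColorClass x c = vcol x ≡ c ⊎ ∃ λ y → x ~ y × ecol x y ≡ c

  Separates : ℕ → A → A → Set
  Separates c x y = ColorClass x c × ¬ ColorClass y c ⊎ ¬ ColorClass x c × ColorClass y c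

Separates-sym : ∀ {A : Set} {_~_ : A → A → Set} {vcol ecol c x y} →
                Separates _~_ vcol ecol c x y → Separates _~_ vcol ecol c y x
Separates-sym (inj₁ (p , q)) = inj₂ (q , p)
Separates-sym (inj₂ (p , q)) = inj₁ (q , p)

record ℕTotalColoring {A : Set} (_~_ : A → A → Set) (k : ℕ) : Set where
  field
    vcol      : A → ℕ
    ecol      : A → A → ℕ
    vcol<     : ∀ x → vcol x < k
    ecol<     : ∀ x y → ecol x y < k
    ecol-sym  : ∀ {x y} → x ~ y → ecol x y ≡ ecol y x
    vproper   : ∀ {x y} → x ~ y → vcol x ≢ vcol y
    eproper   : ∀ {x y z} → x ~ y → x ~ z → y ≢ z → ecol x y ≢ ecol x z
    incproper : ∀ {x y} → x ~ y → vcol x ≢ ecol x y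
    separated : ∀ {x y} → x ~ y → ∃ λ c → Separates _~_ vcol ecol c x y

module _ {A : Set} {n k : ℕ} (H : Graph n) {_~_ : A → A → Set} (φ : Fin n ↔ A)
         (Adj⇔ : ∀ x y → Adj H x y ⇔ Inverse.to φ x ~ Inverse.to φ y) where

  open Inverse φ using (to; from; strictlyInverseˡ; strictlyInverseʳ)

  private
    Adj⇒~ : ∀ {x y} → Adj H x y → to x ~ to y
    Adj⇒~ = Equivalence.to (Adj⇔ _ _)

    ~⇒Adj : ∀ {x y} → to x ~ to y → Adj H x y
    ~⇒Adj = Equivalence.from (Adj⇔ _ _)

  toAVDTotalColoring : ℕTotalColoring _~_ k → AVDTotalColoring H k
  toAVDTotalColoring χ = record
    { vcol      = vcolᶠ
    ; ecol      = ecolᶠ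
    ; ecol-sym  = λ u v u~v → fromℕ<-cong _ _ (ecol-sym (Adj⇒~ u~v)) _ _
    ; vproper   = λ u v u~v eq → vproper (Adj⇒~ u~v) (fromℕ<-injective _ _ _ _ eq)
    ; eproper   = λ u v w u~v u~w v≢w eq →
        eproper (Adj⇒~ u~v) (Adj⇒~ u~w) (v≢w ∘ to-injective) (fromℕ<-injective _ _ _ _ eq)
    ; incproper = λ u v u~v eq → incproper (Adj⇒~ u~v) (fromℕ<-injective _ _ _ _ eq)
    ; avd       = avd
    }
    where
    open ℕTotalColoring χ
    to-injective : ∀ {x y} → to x ≡ to y → x ≡ y
    to-injective {x} {y} eq = trans (sym (strictlyInverseʳ x)) (trans (cong from eq) (strictlyInverseʳ y))
    vcolᶠ : Fin n → Fin k
    vcolᶠ x = fromℕ< (vcol< (to x))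
    ecolᶠ : Fin n → Fin n → Fin k
    ecolᶠ x y = fromℕ< (ecol< (to x) (to y))
    InClass : Fin n → Fin k → Set
    InClass x c = (vcolᶠ x ≡ c) ⊎ Σ (Fin n) (λ y → Adj H x y × (ecolᶠ x y ≡ c))
    Class = ColorClass _~_ vcol ecol
    Class< : ∀ {x c} → Class x c → c < k
    Class< {x} (inj₁ refl) = vcol< x
    Class< {x} (inj₂ (y , _ , refl)) = ecol< x y
    lift : ∀ {x c} → (cl : Class (to x) c) → InClass x (fromℕ< (Class< cl))
    lift (inj₁ eq) = inj₁ (fromℕ<-cong _ _ eq _ _)
    lift {x} (inj₂ (y , x~y , eq)) = inj₂ (from y , ~⇒Adj (subst (to x ~_) (sym (strictlyInverseˡ y)) x~y) ,
                                           fromℕ<-cong _ _ (trans (cong (ecol (to x)) (strictlyInverseˡ y)) eq) _ _)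
    lower : ∀ {x c} .(c<k : c < k) → InClass x (fromℕ< c<k) → Class (to x) c
    lower c<k (inj₁ eq) = inj₁ (fromℕ<-injective _ _ _ c<k eq)
    lower c<k (inj₂ (y , x~y , eq)) = inj₂ (to y , Adj⇒~ x~y , fromℕ<-injective _ _ _ c<k eq)
    avd : ∀ u v → Adj H u v → ¬ (∀ c → InClass u c ⇔ InClass v c)
    avd u v u~v same with separated (Adj⇒~ u~v)
    ... | c , inj₁ (in-u , ∉v) = ∉v (lower (Class< in-u) (Equivalence.to (same _) (lift in-u)))
    ... | c , inj₂ (∉u , in-v) = ∉u (lower (Class< in-v) (Equivalence.from (same _) (lift in-v)))

-- The central graph

join-injective : ∀ m n {a b} → Fin.join m n a ≡ Fin.join m n b → a ≡ b
join-injective m n {a} {b} eq = trans (sym (splitAt-join m n a)) (trans (cong (splitAt m) eq) (splitAt-join m n b))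

data CentralAdj {N} (G : Graph N) : Fin N ⊎ Fin (nE G) → Fin N ⊎ Fin (nE G) → Set where
  nonadjacent : ∀ {u v} → u ≢ v → adj G u v ≡ false → CentralAdj G (inj₁ u) (inj₁ v)
  incident    : ∀ {u e} → Incident G u e → CentralAdj G (inj₁ u) (inj₂ e)
  incident′   : ∀ {u e} → Incident G u e → CentralAdj G (inj₂ e) (inj₁ u)

module _ {N} (G : Graph N) where

  private
    not-true : ∀ {b} → not b ≡ true → b ≡ false
    not-true {false} _ = refl

    CentralAdj⁺ : ∀ {a b} → a ≢ b → centralRel G a b ≡ true ⊎ centralRel G b a ≡ true → CentralAdj G a b
    CentralAdj⁺ {inj₁ u} {inj₁ v} u≢v (inj₁ r) = nonadjacent (λ eq → u≢v (cong inj₁ eq)) (not-true r)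
    CentralAdj⁺ {inj₁ u} {inj₁ v} u≢v (inj₂ r) =
      nonadjacent (λ eq → u≢v (cong inj₁ eq)) (trans (Graph.sym G u v) (not-true r))
    CentralAdj⁺ {inj₁ u} {inj₂ e} _ (inj₁ r) = incident r
    CentralAdj⁺ {inj₂ e} {inj₁ u} _ (inj₂ r) = incident′ r
    CentralAdj⁺ {inj₁ u} {inj₂ e} _ (inj₂ ())
    CentralAdj⁺ {inj₂ e} {inj₁ u} _ (inj₁ ())
    CentralAdj⁺ {inj₂ e} {inj₂ f} _ (inj₁ ())
    CentralAdj⁺ {inj₂ e} {inj₂ f} _ (inj₂ ())

    CentralAdj⁻ : ∀ {a b} → CentralAdj G a b → a ≢ b × (centralRel G a b ≡ true ⊎ centralRel G b a ≡ true)
    CentralAdj⁻ (nonadjacent u≢v a) = (λ eq → u≢v (inj₁-injective eq)) , inj₁ (cong not a)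
    CentralAdj⁻ (incident u∈e)      = (λ ()) , inj₁ u∈e
    CentralAdj⁻ (incident′ u∈e)     = (λ ()) , inj₂ u∈e

  Adj-central⇔ : ∀ x y → Adj (central G) x y ⇔ CentralAdj G (splitAt N x) (splitAt N y)
  Adj-central⇔ x y = mk⇔
    (λ x~y → let x≢y , r = Adj-mkGraph⁻ rel x~y in CentralAdj⁺ (λ eq → x≢y (split-injective eq)) r)
    (λ x~y → let x≢y , r = CentralAdj⁻ x~y in Adj-mkGraph⁺ rel (λ eq → x≢y (cong (splitAt N) eq)) r)
    where
    rel : Fin (N + nE G) → Fin (N + nE G) → Bool
    rel x y = centralRel G (splitAt N x) (splitAt N y)
    split-injective : ∀ {x y} → splitAt N x ≡ splitAt N y → x ≡ y
    split-injective {x} {y} eq = trans (sym (join-splitAt N (nE G) x)) (trans (cong (Fin.join N (nE G)) eq) (join-splitAt N (nE G) y))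

  central-AVD-TCC : ℕTotalColoring (CentralAdj G) (Δ (central G) + 3) → AVD-TCC (central G)
  central-AVD-TCC = toAVDTotalColoring (central G) +↔⊎ Adj-central⇔

  Adj-central⁺ : ∀ {a b} → CentralAdj G a b → Adj (central G) (Fin.join N (nE G) a) (Fin.join N (nE G) b)
  Adj-central⁺ {a} {b} a~b = Equivalence.from (Adj-central⇔ _ _)
    (subst₂ (CentralAdj G) (sym (splitAt-join N (nE G) a)) (sym (splitAt-join N (nE G) b)) a~b)

  direction : Fin N → Fin N ⊎ Fin (nE G) → Fin N
  direction u (inj₁ v) = v
  direction u (inj₂ e) = other G u (edge G e)

  private
    toward′ : ∀ u v b → adj G u v ≡ b → Fin N ⊎ Fin (nE G)
    toward′ u v true  u~v = inj₂ (proj₁ (edge-between G u~v))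
    toward′ u v false _   = inj₁ v

  toward : Fin N → Fin N → Fin N ⊎ Fin (nE G)
  toward u v = toward′ u v (adj G u v) refl

  toward-adj : ∀ {u v} → u ≢ v → CentralAdj G (inj₁ u) (toward u v)
  toward-adj {u} {v} u≢v = go (adj G u v) refl
    where
    go : ∀ b (u~v : adj G u v ≡ b) → CentralAdj G (inj₁ u) (toward′ u v b u~v)
    go true  u~v = incident (proj₁ (proj₂ (edge-between G u~v)))
    go false u≁v = nonadjacent u≢v u≁v

  direction-toward : ∀ u v → direction u (toward u v) ≡ v
  direction-toward u v = go (adj G u v) refl
    where
    go : ∀ b (u~v : adj G u v ≡ b) → direction u (toward′ u v b u~v) ≡ v
    go true  u~v = proj₂ (proj₂ (edge-between G u~v))
    go false _   = refl

  toward-direction : ∀ {u y} → CentralAdj G (inj₁ u) y → toward u (direction u y) ≡ y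
  toward-direction {u} (nonadjacent {v = v} _ u≁v) = go (adj G u v) refl
    where
    go : ∀ b (u~v : adj G u v ≡ b) → toward′ u v b u~v ≡ inj₁ v
    go true  u~v with () ← trans (sym u~v) u≁v
    go false _   = refl
  toward-direction {u} (incident {e = e} u∈e) = go (adj G u v) refl
    where
    v : Fin N
    v = other G u (edge G e)
    go : ∀ b (u~v : adj G u v ≡ b) → toward′ u v b u~v ≡ inj₂ e
    go true  u~v = let _ , u∈e′ , other≡v = edge-between G u~v in cong inj₂ (other-injective G u∈e′ u∈e other≡v)
    go false u≁v with () ← trans (sym u≁v) (Adj-other G u∈e)

  direction≢ : ∀ {u y} → CentralAdj G (inj₁ u) y → direction u y ≢ u
  direction≢ (nonadjacent u≢v _) v≡u = u≢v (sym v≡u)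
  direction≢ (incident u∈e) = λ eq → Adj⇒≢ G (Adj-other G u∈e) (sym eq)

  central-Δ≥2 : Fin (nE G) → 2 ≤ Δ (central G)
  central-Δ≥2 e = ≤-trans (≤-deg (central G) w ends ends-injective ends-adj) (deg≤Δ (central G) w)
    where
    w : Fin (N + nE G)
    w = Fin.join N (nE G) (inj₂ e)
    ends : Fin 2 → Fin (N + nE G)
    ends zero       = Fin.join N (nE G) (inj₁ (proj₁ (edge G e)))
    ends (suc zero) = Fin.join N (nE G) (inj₁ (proj₂ (edge G e)))
    ends-injective : ∀ {i j} → ends i ≡ ends j → i ≡ j
    ends-injective {zero}     {zero}     _  = refl
    ends-injective {zero}     {suc zero} eq = ⊥-elim (Adj⇒≢ G (edge-Adj G e) (inj₁-injective (join-injective N (nE G) eq)))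
    ends-injective {suc zero} {zero}     eq =
      ⊥-elim (Adj⇒≢ G (edge-Adj G e) (inj₁-injective (join-injective N (nE G) (sym eq))))
    ends-injective {suc zero} {suc zero} _  = refl
    ends-adj : ∀ i → Adj (central G) w (ends i)
    ends-adj zero       = Adj-central⁺ (incident′ (proj₁ (fst-incident G e)))
    ends-adj (suc zero) = Adj-central⁺ (incident′ (proj₁ (snd-incident G e)))

central-Δ≥ : ∀ {N} (G : Graph N) → Fin N → N ≤ suc (Δ (central G))
central-Δ≥ {suc N} G _ =
  s≤s (≤-trans (≤-deg (central G) centre neighbour neighbour-injective neighbour-adj) (deg≤Δ (central G) centre))
  where
  centre : Fin (suc N + nE G)
  centre = Fin.join (suc N) (nE G) (inj₁ zero)
  neighbour : Fin N → Fin (suc N + nE G)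
  neighbour i = Fin.join (suc N) (nE G) (toward G zero (suc i))
  neighbour-injective : ∀ {i j} → neighbour i ≡ neighbour j → i ≡ j
  neighbour-injective {i} {j} eq = Fin-suc-injective (begin
    suc i                                     ≡⟨ direction-toward G zero (suc i) ⟨
    direction G zero (toward G zero (suc i))
      ≡⟨ cong (direction G zero) (join-injective (suc N) (nE G) {toward G zero (suc i)} {toward G zero (suc j)} eq) ⟩
    direction G zero (toward G zero (suc j))  ≡⟨ direction-toward G zero (suc j) ⟩
    suc j                                     ∎)
    where open ≡-Reasoning
  neighbour-adj : ∀ i → Adj (central G) centre (neighbour i)
  neighbour-adj i = Adj-central⁺ G {inj₁ zero} (toward-adj G {zero} {suc i} (λ ()))

-- The coloring of C(G) along a vertex order

module OrderColoring {N} (G : Graph N) (π : Permutation′ N) where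

  pos : Fin N → ℕ
  pos v = toℕ (π ⟨$⟩ʳ v)

  pos<N : ∀ v → pos v < N
  pos<N v = toℕ<n (π ⟨$⟩ʳ v)

  pos≤1+N : ∀ v → pos v ≤ suc N
  pos≤1+N v = ≤-trans (<⇒≤ (pos<N v)) (n≤1+n N)

  pos-injective : ∀ {u v} → pos u ≡ pos v → u ≡ v
  pos-injective {u} {v} eq = trans (sym (inverseˡ π)) (trans (cong (π ⟨$⟩ˡ_) (toℕ-injective eq)) (inverseˡ π))

  at : ∀ t → t < N → Fin N
  at t t<N = π ⟨$⟩ˡ fromℕ< t<N

  pos-at : ∀ t (t<N : t < N) → pos (at t t<N) ≡ t
  pos-at t t<N = trans (cong toℕ (inverseʳ π)) (toℕ-fromℕ< t<N)

  Lower : Fin N → Fin N → Set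
  Lower v k = Adj G k v × pos k < pos v

  lower? : ∀ v k → Dec (Lower v k)
  lower? v k = (adj G k v Bool.≟ true) ×-dec (pos k <? pos v)

  private
    lowerFrom : Fin N → ℕ → List ℕ
    lowerFrom v t = map pos (filter (λ k → lower? v k ×-dec (t ≤? pos k)) (allFin N))

  nextLower : Fin N → ℕ → ℕ
  nextLower v t = min (suc N) (lowerFrom v t)

  nextLower-sel : ∀ v t → nextLower v t ≡ suc N ⊎ ∃ λ k → Lower v k × t ≤ pos k × nextLower v t ≡ pos k
  nextLower-sel v t with argmin-sel (λ n → n) (suc N) (lowerFrom v t)
  ... | inj₁ eq = inj₁ eq
  ... | inj₂ ∈ks with ∈-map⁻ pos ∈ks
  ...   | k , ∈filter , eq with ∈-filter⁻ (λ k → lower? v k ×-dec (t ≤? pos k)) {xs = allFin N} ∈filter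
  ...     | _ , (k<v , t≤k) = inj₂ (k , k<v , t≤k , eq)

  nextLower-min : ∀ {v t k} → Lower v k → t ≤ pos k → nextLower v t ≤ pos k
  nextLower-min {v} {t} {k} k<v t≤k = min≤v⁺ (suc N) (lowerFrom v t) (inj₂ (lose
    (∈-map⁺ pos (∈-filter⁺ (λ k → lower? v k ×-dec (t ≤? pos k)) (∈-allFin k) (k<v , t≤k))) ≤-refl))

  nextLower≤ : ∀ v t → nextLower v t ≤ suc N
  nextLower≤ v t = min≤⊤ (suc N) (lowerFrom v t)

  nextLower≥ : ∀ v {t} → t ≤ suc N → t ≤ nextLower v t
  nextLower≥ v {t} t≤ with nextLower-sel v t
  ... | inj₁ eq = subst (t ≤_) (sym eq) t≤
  ... | inj₂ (_ , _ , t≤k , eq) = subst (t ≤_) (sym eq) t≤k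

  nextLower≢N : ∀ v t → nextLower v t ≢ N
  nextLower≢N v t eq with nextLower-sel v t
  ... | inj₁ eq′ = 1+n≢n (trans (sym eq′) eq)
  ... | inj₂ (k , _ , _ , eq′) = <⇒≢ (pos<N k) (trans (sym eq′) eq)

  nextLower≡pos⇒Lower : ∀ {v t k} → nextLower v t ≡ pos k → Lower v k
  nextLower≡pos⇒Lower {v} {t} {k} eq with nextLower-sel v t
  ... | inj₁ eq′ = ⊥-elim (<-irrefl (sym (trans (sym eq′) eq)) (≤-trans (pos<N k) (n≤1+n N)))
  ... | inj₂ (y , y<v , _ , eq′) = subst (Lower v) (pos-injective (trans (sym eq′) eq)) y<v

  slot : Fin N → Fin N → ℕ
  slot v k with lower? v k
  ... | yes _ = nextLower v (suc (pos k))
  ... | no  _ = pos k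

  slot-cases : ∀ v k → (Lower v k × slot v k ≡ nextLower v (suc (pos k))) ⊎ (¬ Lower v k × slot v k ≡ pos k)
  slot-cases v k with lower? v k
  ... | yes k<v = inj₁ (k<v , refl)
  ... | no  k≮v = inj₂ (k≮v , refl)

  slot-nonlower : ∀ {v k} → ¬ Lower v k → slot v k ≡ pos k
  slot-nonlower {v} {k} k≮v with slot-cases v k
  ... | inj₁ (k<v , _) = ⊥-elim (k≮v k<v)
  ... | inj₂ (_ , eq)  = eq

  slot-self : ∀ v → slot v v ≡ pos v
  slot-self v = slot-nonlower (λ (_ , v<v) → <-irrefl refl v<v)

  pos<slot : ∀ {v k} → Lower v k → pos k < slot v k
  pos<slot {v} {k} k<v with slot-cases v k
  ... | inj₁ (_ , eq) = subst (pos k <_) (sym eq) (nextLower≥ v (s≤s (<⇒≤ (pos<N k))))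
  ... | inj₂ (k≮v , _) = ⊥-elim (k≮v k<v)

  slot≤ : ∀ v k → slot v k ≤ suc N
  slot≤ v k with slot-cases v k
  ... | inj₁ (_ , eq) = subst (_≤ suc N) (sym eq) (nextLower≤ v _)
  ... | inj₂ (_ , eq) = subst (_≤ suc N) (sym eq) (pos≤1+N k)

  slot≢N : ∀ v k → slot v k ≢ N
  slot≢N v k with slot-cases v k
  ... | inj₁ (_ , eq) = λ eq′ → nextLower≢N v _ (trans (sym eq) eq′)
  ... | inj₂ (_ , eq) = λ eq′ → <⇒≢ (pos<N k) (trans (sym eq) eq′)

  slot-lower : ∀ {v k} → Lower v k → slot v k ≡ nextLower v (suc (pos k))
  slot-lower {v} {k} k<v with slot-cases v k
  ... | inj₁ (_ , eq)  = eq
  ... | inj₂ (k≮v , _) = ⊥-elim (k≮v k<v)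

  slot-increasing : ∀ {v k k′} → Lower v k → Lower v k′ → pos k < pos k′ → slot v k < slot v k′
  slot-increasing {v} {k} {k′} k<v k′<v k<k′ =
    ≤-<-trans (subst (_≤ pos k′) (sym (slot-lower k<v)) (nextLower-min k′<v k<k′)) (pos<slot k′<v)

  slot-injective : ∀ v {k k′} → slot v k ≡ slot v k′ → k ≡ k′
  slot-injective v {k} {k′} eq with slot-cases v k | slot-cases v k′
  ... | inj₂ (_ , e) | inj₂ (_ , e′) = pos-injective (trans (sym e) (trans eq e′))
  ... | inj₁ (_ , e) | inj₂ (k′≮v , e′) = ⊥-elim (k′≮v (nextLower≡pos⇒Lower (trans (sym e) (trans eq e′))))
  ... | inj₂ (k≮v , e) | inj₁ (_ , e′) = ⊥-elim (k≮v (nextLower≡pos⇒Lower (trans (sym e′) (trans (sym eq) e))))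
  ... | inj₁ (k<v , _) | inj₁ (k′<v , _) with <-cmp (pos k) (pos k′)
  ...   | tri< k<k′ _ _ = ⊥-elim (<-irrefl eq (slot-increasing k<v k′<v k<k′))
  ...   | tri≈ _ k≡k′ _ = pos-injective k≡k′
  ...   | tri> _ _ k′<k = ⊥-elim (<-irrefl (sym eq) (slot-increasing k′<v k<v k′<k))

  spare : Fin N → ℕ
  spare v = nextLower v 0

  slot≢spare : ∀ v k → slot v k ≢ spare v
  slot≢spare v k eq with slot-cases v k
  ... | inj₁ (k<v , _) = <⇒≢ (≤-<-trans (nextLower-min k<v z≤n) (pos<slot k<v)) (sym eq)
  ... | inj₂ (k≮v , e) = k≮v (nextLower≡pos⇒Lower (trans (sym eq) e))

  slot-surjective : ∀ v {t} → t < N → t ≢ spare v → ∃ λ k → slot v k ≡ t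
  slot-surjective v {t} t<N t≢spare with lower? v (at t t<N)
  ... | no  k≮v = at t t<N , trans (slot-nonlower k≮v) (pos-at t t<N)
  ... | yes k<v = i , ≤-antisym slot≤t t≤slot
    where
    Below : Fin N → Set
    Below x = Lower v x × pos x < t
    below? : ∀ x → Dec (Below x)
    below? x = lower? v x ×-dec (pos x <? t)
    spare<t : spare v < t
    spare<t = ≤∧≢⇒< (subst (spare v ≤_) (pos-at t t<N) (nextLower-min k<v z≤n)) (λ eq → t≢spare (sym eq))
    first : ∃ Below
    first with nextLower-sel v 0
    ... | inj₁ eq = ⊥-elim (<-asym (<-trans spare<t t<N) (subst (N <_) (sym eq) (n<1+n N)))
    ... | inj₂ (y , y<v , _ , eq) = y , y<v , subst (_< t) eq spare<t
    candidates : List (Fin N)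
    candidates = filter below? (allFin N)
    i : Fin N
    i = argmax pos (proj₁ first) candidates
    i-below : Below i
    i-below = argmax-all pos {P = Below} (proj₂ first) (All.all-filter below? (allFin N))
    i-max : ∀ {x} → Below x → pos x ≤ pos i
    i-max {x} bx = All.lookup (f[xs]≤f[argmax] {f = pos} (proj₁ first) candidates) (∈-filter⁺ below? (∈-allFin x) bx)
    slot≤t : slot v i ≤ t
    slot≤t = subst₂ _≤_ (sym (slot-lower (proj₁ i-below))) (pos-at t t<N)
                    (nextLower-min k<v (subst (pos i <_) (sym (pos-at t t<N)) (proj₂ i-below)))
    t≤slot : t ≤ slot v i
    t≤slot with nextLower-sel v (suc (pos i))
    ... | inj₁ eq = subst (t ≤_) (sym (trans (slot-lower (proj₁ i-below)) eq)) (≤-trans (<⇒≤ t<N) (n≤1+n N))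
    ... | inj₂ (y , y<v , i<y , eq) = subst (t ≤_) (sym (trans (slot-lower (proj₁ i-below)) eq))
                                        (≮⇒≥ (λ y<t → <⇒≱ i<y (i-max (y<v , y<t))))

  q : ℕ
  q = suc (2 * proj₁ (odd-between N))

  N<q : N < q
  N<q = proj₁ (proj₂ (odd-between N))

  q≤2+N : q ≤ 2 + N
  q≤2+N = proj₂ (proj₂ (odd-between N))

  open ReduceOnce q

  -- The index t = q occurs only when q = N + 1, and then gets the extra color q.
  col : Fin N → ℕ → ℕ
  col v t with t <? q
  ... | yes _ = reduce (pos v + t)
  ... | no  _ = q

  col-cases : ∀ v t → (t < q × col v t ≡ reduce (pos v + t)) ⊎ (q ≤ t × col v t ≡ q)
  col-cases v t with t <? q
  ... | yes t<q = inj₁ (t<q , refl)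
  ... | no  t≮q = inj₂ (≮⇒≥ t≮q , refl)

  col-< : ∀ v {t} → t < q → col v t ≡ reduce (pos v + t)
  col-< v {t} t<q with col-cases v t
  ... | inj₁ (_ , eq)   = eq
  ... | inj₂ (q≤t , _) = ⊥-elim (<⇒≱ t<q q≤t)

  private
    pos<q : ∀ v → pos v < q
    pos<q v = <-trans (pos<N v) N<q

    reduce<q : ∀ v {t} → t < q → reduce (pos v + t) < q
    reduce<q v t<q = reduce< (+-mono-< (pos<q v) t<q)

  col< : ∀ v {t} → t ≤ suc N → col v t < 2 + N
  col< v {t} t≤ with col-cases v t
  ... | inj₁ (t<q , eq) = subst (_< 2 + N) (sym eq) (<-≤-trans (reduce<q v t<q) q≤2+N)
  ... | inj₂ (q≤t , eq) = subst (_< 2 + N) (sym eq) (s≤s (≤-trans q≤t t≤))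

  col-injective : ∀ v {t t′} → t ≤ suc N → t′ ≤ suc N → col v t ≡ col v t′ → t ≡ t′
  col-injective v {t} {t′} t≤ t′≤ eq with col-cases v t | col-cases v t′
  ... | inj₁ (t<q , e) | inj₁ (t′<q , e′) = reduce-+-injectiveʳ (pos v) t<q t′<q (trans (sym e) (trans eq e′))
  ... | inj₁ (t<q , e) | inj₂ (_ , e′)    = ⊥-elim (<⇒≢ (reduce<q v t<q) (trans (sym e) (trans eq e′)))
  ... | inj₂ (_ , e)   | inj₁ (t′<q , e′) = ⊥-elim (<⇒≢ (reduce<q v t′<q) (trans (sym e′) (trans (sym eq) e)))
  ... | inj₂ (q≤t , _) | inj₂ (q≤t′ , _)  = trans (top t≤ q≤t) (sym (top t′≤ q≤t′))
    where
    top : ∀ {t} → t ≤ suc N → q ≤ t → t ≡ suc N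
    top t≤ q≤t = ≤-antisym t≤ (≤-trans N<q q≤t)

  col-comm : ∀ u v → col u (pos v) ≡ col v (pos u)
  col-comm u v = trans (col-< u (pos<q v)) (trans (cong reduce (+-comm (pos u) (pos v))) (sym (col-< v (pos<q u))))

  col-shift : ∀ u v {t} → t < N → pos v + t ≡ pos u + N → col v t ≡ col u N
  col-shift u v t<N eq = trans (col-< v (<-trans t<N N<q)) (trans (cong reduce eq) (sym (col-< u N<q)))

  vertexColor : Fin N → ℕ
  vertexColor v = col v (pos v)

  dartColor : Fin N → Fin N → ℕ
  dartColor v k = col v (slot v k)

  vertexColor-injective : ∀ {u v} → vertexColor u ≡ vertexColor v → u ≡ v
  vertexColor-injective {u} {v} eq = pos-injective (reduce-double-injective (proj₁ (odd-between N)) refl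
    (trans (sym (col-< u (pos<q u))) (trans eq (col-< v (pos<q v)))))

  dartColor-injective : ∀ v {k k′} → dartColor v k ≡ dartColor v k′ → k ≡ k′
  dartColor-injective v {k} {k′} eq = slot-injective v (col-injective v (slot≤ v k) (slot≤ v k′) eq)

  vertexColor≡dartColor : ∀ v → vertexColor v ≡ dartColor v v
  vertexColor≡dartColor v = cong (col v) (sym (slot-self v))

  dartColor-up : ∀ {a b} → pos a < pos b → dartColor a b ≡ col b (pos a)
  dartColor-up {a} {b} a<b = trans (cong (col a) (slot-nonlower (λ (_ , b<a) → <-asym a<b b<a))) (col-comm a b)

  dartColor-down≢ : ∀ {a b} → Adj G a b → pos a < pos b → dartColor b a ≢ col b (pos a)
  dartColor-down≢ {a} {b} a~b a<b eq =
    <⇒≢ (pos<slot (a~b , a<b)) (sym (col-injective b (slot≤ b a) (pos≤1+N a) eq))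

  dartColor-antisym : ∀ {a b} → Adj G a b → dartColor a b ≢ dartColor b a
  dartColor-antisym {a} {b} a~b eq with <-cmp (pos a) (pos b)
  ... | tri< a<b _ _ = dartColor-down≢ a~b a<b (trans (sym eq) (dartColor-up a<b))
  ... | tri≈ _ a≡b _ = Adj⇒≢ G a~b (pos-injective a≡b)
  ... | tri> _ _ b<a = dartColor-down≢ (Adj-sym G a~b) b<a (trans eq (dartColor-up b<a))

  Unused : Fin N → ℕ → Set
  Unused v σ = σ ≤ suc N × ∀ k → slot v k ≢ σ

  unused≢dartColor : ∀ {v σ} → Unused v σ → ∀ k → col v σ ≢ dartColor v k
  unused≢dartColor {v} (σ≤ , unused) k eq = unused k (sym (col-injective v σ≤ (slot≤ v k) eq))

  spareColor : Fin N → ℕ → ℕ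
  spareColor v c with col v N ≟ c
  ... | no  _ = col v N
  ... | yes _ = col v (spare v)

  spareColor-spec : ∀ v c → ∃ λ σ → Unused v σ × col v σ ≢ c × spareColor v c ≡ col v σ
  spareColor-spec v c with col v N ≟ c
  ... | no  vN≢c = N , (n≤1+n N , λ k → slot≢N v k) , vN≢c , refl
  ... | yes vN≡c = spare v , (nextLower≤ v 0 , λ k → slot≢spare v k) , spare≢c , refl
    where
    spare≢c : col v (spare v) ≢ c
    spare≢c eq = nextLower≢N v 0 (col-injective v (nextLower≤ v 0) (n≤1+n N) (trans eq (sym vN≡c)))

  record SubdivisionColor (a b : Fin N) (c : ℕ) : Set where
    field
      ≢vertexˡ   : c ≢ vertexColor a
      ≢vertexʳ   : c ≢ vertexColor b
      ≢dartˡ     : c ≢ dartColor a b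
      ≢dartʳ     : c ≢ dartColor b a
      bounded    : c < 5 ⊎ c < 2 + N
      separatesˡ : dartColor b a ≢ vertexColor a ⊎ ∃ λ σ → Unused a σ × c ≡ col a σ

  private
    forbidden : Fin N → Fin N → List ℕ
    forbidden a b = vertexColor a ∷ vertexColor b ∷ dartColor a b ∷ dartColor b a ∷ []

  -- If the half-edge at b already carries the color of a, the classes of a and
  -- of the subdivision vertex are told apart by a color missing at a;
  -- otherwise by the color of a itself.
  subdivisionColor : Fin N → Fin N → ℕ
  subdivisionColor a b with dartColor b a ≟ vertexColor a
  ... | no  _ = proj₁ (∃∉-≤-length (forbidden a b))
  ... | yes _ = spareColor a (vertexColor b)

  subdivisionColor-spec : ∀ a b → SubdivisionColor a b (subdivisionColor a b)
  subdivisionColor-spec a b with dartColor b a ≟ vertexColor a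
  ... | no ba≢a = record
    { ≢vertexˡ   = λ eq → c∉ (here eq)
    ; ≢vertexʳ   = λ eq → c∉ (there (here eq))
    ; ≢dartˡ     = λ eq → c∉ (there (there (here eq)))
    ; ≢dartʳ     = λ eq → c∉ (there (there (there (here eq))))
    ; bounded    = inj₁ (s≤s (proj₁ (proj₂ (∃∉-≤-length (forbidden a b)))))
    ; separatesˡ = inj₁ ba≢a
    }
    where
    c∉ : proj₁ (∃∉-≤-length (forbidden a b)) ∉ forbidden a b
    c∉ = proj₂ (proj₂ (∃∉-≤-length (forbidden a b)))
  ... | yes ba≡a with spareColor-spec a (vertexColor b)
  ...   | σ , σ-unused , ≢b , eq = record
    { ≢vertexˡ   = ≢a
    ; ≢vertexʳ   = λ e → ≢b (trans (sym eq) e)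
    ; ≢dartˡ     = λ e → unused≢dartColor σ-unused b (trans (sym eq) e)
    ; ≢dartʳ     = λ e → ≢a (trans e ba≡a)
    ; bounded    = inj₂ (subst (_< 2 + N) (sym eq) (col< a (proj₁ σ-unused)))
    ; separatesˡ = inj₂ (σ , σ-unused , eq)
    }
    where
    ≢a : spareColor a (vertexColor b) ≢ vertexColor a
    ≢a e = unused≢dartColor σ-unused a (trans (sym eq) (trans e (vertexColor≡dartColor a)))

  orient : Fin N × Fin N → Fin N × Fin N
  orient (a , b) with pos a <? pos b
  ... | yes _ = (a , b)
  ... | no  _ = (b , a)

  lo hi : Fin (nE G) → Fin N
  lo e = proj₁ (orient (edge G e))
  hi e = proj₂ (orient (edge G e))

  edge-ends : ∀ e → edge G e ≡ (lo e , hi e) ⊎ edge G e ≡ (hi e , lo e)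
  edge-ends e with pos (proj₁ (edge G e)) <? pos (proj₂ (edge G e))
  ... | yes _ = inj₁ refl
  ... | no  _ = inj₂ refl

  lo<hi : ∀ e → pos (lo e) < pos (hi e)
  lo<hi e with pos (proj₁ (edge G e)) <? pos (proj₂ (edge G e))
  ... | yes a<b = a<b
  ... | no  a≮b = ≤∧≢⇒< (≮⇒≥ a≮b) (λ eq → Adj⇒≢ G (edge-Adj G e) (pos-injective (sym eq)))

  lo~hi : ∀ e → Adj G (lo e) (hi e)
  lo~hi e with edge-ends e
  ... | inj₁ eq = subst (λ p → Adj G (proj₁ p) (proj₂ p)) eq (edge-Adj G e)
  ... | inj₂ eq = Adj-sym G (subst (λ p → Adj G (proj₁ p) (proj₂ p)) eq (edge-Adj G e))

  incident-ends : ∀ {u e} → Incident G u e →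
                  (u ≡ lo e × other G u (edge G e) ≡ hi e) ⊎ (u ≡ hi e × other G u (edge G e) ≡ lo e)
  incident-ends {u} {e} u∈e with incident-edge G u∈e | edge-ends e
  ... | inj₁ p | inj₁ p′ = inj₁ (cong proj₁ (trans (sym p) p′) , cong proj₂ (trans (sym p) p′))
  ... | inj₁ p | inj₂ p′ = inj₂ (cong proj₁ (trans (sym p) p′) , cong proj₂ (trans (sym p) p′))
  ... | inj₂ p | inj₁ p′ = inj₂ (cong proj₂ (trans (sym p) p′) , cong proj₁ (trans (sym p) p′))
  ... | inj₂ p | inj₂ p′ = inj₁ (cong proj₂ (trans (sym p) p′) , cong proj₁ (trans (sym p) p′))

  vcol : Fin N ⊎ Fin (nE G) → ℕ
  vcol (inj₁ v) = vertexColor v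
  vcol (inj₂ e) = subdivisionColor (lo e) (hi e)

  ecol : Fin N ⊎ Fin (nE G) → Fin N ⊎ Fin (nE G) → ℕ
  ecol (inj₁ u) y        = dartColor u (direction G u y)
  ecol (inj₂ e) (inj₁ u) = dartColor u (other G u (edge G e))
  ecol (inj₂ _) (inj₂ _) = 0  -- junk: subdivision vertices are never adjacent

  Class : Fin N ⊎ Fin (nE G) → ℕ → Set
  Class = ColorClass (CentralAdj G) vcol ecol

  Class-original⁻ : ∀ {u c} → Class (inj₁ u) c → ∃ λ k → dartColor u k ≡ c
  Class-original⁻ {u} (inj₁ eq)            = u , trans (sym (vertexColor≡dartColor u)) eq
  Class-original⁻ {u} (inj₂ (y , _ , eq)) = direction G u y , eq

  Class-original⁺ : ∀ u k → Class (inj₁ u) (dartColor u k)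
  Class-original⁺ u k with k ≟ᶠ u
  ... | yes refl = inj₁ (vertexColor≡dartColor u)
  ... | no  k≢u  =
    inj₂ (toward G u k , toward-adj G (λ u≡k → k≢u (sym u≡k)) , cong (dartColor u) (direction-toward G u k))

  unused∉Class : ∀ {u σ} → Unused u σ → ¬ Class (inj₁ u) (col u σ)
  unused∉Class σ-unused cl = let k , eq = Class-original⁻ cl in unused≢dartColor σ-unused k (sym eq)

  Class-subdivision⁻ : ∀ {e c} → Class (inj₂ e) c →
                       vcol (inj₂ e) ≡ c ⊎ dartColor (lo e) (hi e) ≡ c ⊎ dartColor (hi e) (lo e) ≡ c
  Class-subdivision⁻ (inj₁ eq) = inj₁ eq
  Class-subdivision⁻ {e} {c} (inj₂ (inj₁ u , incident′ u∈e , eq)) = inj₂ (towards (incident-ends u∈e))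
    where
    towards : (u ≡ lo e × other G u (edge G e) ≡ hi e) ⊎ (u ≡ hi e × other G u (edge G e) ≡ lo e) →
              dartColor (lo e) (hi e) ≡ c ⊎ dartColor (hi e) (lo e) ≡ c
    towards (inj₁ (u≡lo , o≡hi)) = inj₁ (trans (cong₂ dartColor (sym u≡lo) (sym o≡hi)) eq)
    towards (inj₂ (u≡hi , o≡lo)) = inj₂ (trans (cong₂ dartColor (sym u≡hi) (sym o≡lo)) eq)

  private
    spec : ∀ e → SubdivisionColor (lo e) (hi e) (vcol (inj₂ e))
    spec e = subdivisionColor-spec (lo e) (hi e)

    Ends : Fin N → Fin (nE G) → Set
    Ends u e = (u ≡ lo e × other G u (edge G e) ≡ hi e) ⊎ (u ≡ hi e × other G u (edge G e) ≡ lo e)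

    nonadjacent⇒¬Lower : ∀ {u v} → adj G u v ≡ false → ¬ Lower u v
    nonadjacent⇒¬Lower {u} {v} u≁v (v~u , _) with () ← trans (sym u≁v) (trans (Graph.sym G u v) v~u)

  ecol-sym : ∀ {x y} → CentralAdj G x y → ecol x y ≡ ecol y x
  ecol-sym (nonadjacent {u} {v} _ u≁v) = begin
    col u (slot u v) ≡⟨ cong (col u) (slot-nonlower (nonadjacent⇒¬Lower u≁v)) ⟩
    col u (pos v)    ≡⟨ col-comm u v ⟩
    col v (pos u)    ≡⟨ cong (col v) (slot-nonlower (nonadjacent⇒¬Lower (trans (Graph.sym G v u) u≁v))) ⟨
    col v (slot v u) ∎
    where open ≡-Reasoning
  ecol-sym (incident _)  = refl
  ecol-sym (incident′ _) = refl

  vproper : ∀ {x y} → CentralAdj G x y → vcol x ≢ vcol y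
  vproper (nonadjacent u≢v _) eq = u≢v (vertexColor-injective eq)
  vproper (incident u∈e)      eq = vertex≢subdivision (incident-ends u∈e) eq
    where
    vertex≢subdivision : ∀ {u e} → Ends u e → vertexColor u ≢ vcol (inj₂ e)
    vertex≢subdivision {e = e} (inj₁ (refl , _)) eq = SubdivisionColor.≢vertexˡ (spec e) (sym eq)
    vertex≢subdivision {e = e} (inj₂ (refl , _)) eq = SubdivisionColor.≢vertexʳ (spec e) (sym eq)
  vproper (incident′ u∈e)     eq = vproper (incident u∈e) (sym eq)

  eproper : ∀ {x y z} → CentralAdj G x y → CentralAdj G x z → y ≢ z → ecol x y ≢ ecol x z
  eproper {inj₁ u} u~y u~z y≢z eq =
    y≢z (trans (sym (toward-direction G u~y)) (trans (cong (toward G u) (dartColor-injective u eq)) (toward-direction G u~z)))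
  eproper {inj₂ e} (incident′ u∈e) (incident′ u′∈e) = distinct (incident-ends u∈e) (incident-ends u′∈e)
    where
    distinct : ∀ {u u′} → Ends u e → Ends u′ e → inj₁ u ≢ inj₁ u′ →
               dartColor u (other G u (edge G e)) ≢ dartColor u′ (other G u′ (edge G e))
    distinct (inj₁ (refl , _))     (inj₁ (refl , _))     y≢z _  = y≢z refl
    distinct (inj₂ (refl , _))     (inj₂ (refl , _))     y≢z _  = y≢z refl
    distinct (inj₁ (refl , o≡hi)) (inj₂ (refl , o′≡lo)) _   eq =
      dartColor-antisym (lo~hi e) (trans (cong (dartColor (lo e)) (sym o≡hi)) (trans eq (cong (dartColor (hi e)) o′≡lo)))
    distinct (inj₂ (refl , o≡lo)) (inj₁ (refl , o′≡hi)) _   eq =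
      dartColor-antisym (lo~hi e) (trans (cong (dartColor (lo e)) (sym o′≡hi)) (trans (sym eq) (cong (dartColor (hi e)) o≡lo)))

  incproper : ∀ {x y} → CentralAdj G x y → vcol x ≢ ecol x y
  incproper {inj₁ u} u~y eq = direction≢ G u~y (sym (dartColor-injective u (trans (sym (vertexColor≡dartColor u)) eq)))
  incproper {inj₂ e} (incident′ u∈e) = subdivision≢dart (incident-ends u∈e)
    where
    subdivision≢dart : ∀ {u} → Ends u e → vcol (inj₂ e) ≢ dartColor u (other G u (edge G e))
    subdivision≢dart (inj₁ (refl , o≡hi)) eq = SubdivisionColor.≢dartˡ (spec e) (trans eq (cong (dartColor (lo e)) o≡hi))
    subdivision≢dart (inj₂ (refl , o≡lo)) eq = SubdivisionColor.≢dartʳ (spec e) (trans eq (cong (dartColor (hi e)) o≡lo))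

  private
    small< : ∀ {c} → Fin N → c < 2 + N → c < Δ (central G) + 3
    small< {c} v c<2+N = <-≤-trans c<2+N (subst (2 + N ≤_) (+-comm 3 (Δ (central G))) (s≤s (s≤s (central-Δ≥ G v))))

    five< : ∀ {c} → Fin (nE G) → c < 5 → c < Δ (central G) + 3
    five< {c} e c<5 = <-≤-trans c<5 (+-monoˡ-≤ 3 (central-Δ≥2 G e))

    dart< : ∀ u k → dartColor u k < Δ (central G) + 3
    dart< u k = small< u (col< u (slot≤ u k))

  vcol< : ∀ x → vcol x < Δ (central G) + 3
  vcol< (inj₁ v) = small< v (col< v (pos≤1+N v))
  vcol< (inj₂ e) = [ five< e , small< (lo e) ]′ (SubdivisionColor.bounded (spec e))

  ecol< : ∀ x y → ecol x y < Δ (central G) + 3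
  ecol< (inj₁ u) y        = dart< u (direction G u y)
  ecol< (inj₂ e) (inj₁ u) = dart< u (other G u (edge G e))
  ecol< (inj₂ _) (inj₂ _) = ≤-trans (s≤s z≤n) (m≤n+m 3 (Δ (central G)))

  Separated : Fin N ⊎ Fin (nE G) → Fin N ⊎ Fin (nE G) → Set
  Separated x y = ∃ λ c → Separates (CentralAdj G) vcol ecol c x y

  Separated-sym : ∀ {x y} → Separated x y → Separated y x
  Separated-sym (c , sep) = c , Separates-sym {_~_ = CentralAdj G} {vcol} {ecol} sep

  private
    lo≢hi : ∀ e → lo e ≢ hi e
    lo≢hi e = Adj⇒≢ G (lo~hi e)

  separated-lo : ∀ e → Separated (inj₁ (lo e)) (inj₂ e)
  separated-lo e = from-spec (SubdivisionColor.separatesˡ (spec e))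
    where
    from-spec : dartColor (hi e) (lo e) ≢ vertexColor (lo e) ⊎ (∃ λ σ → Unused (lo e) σ × vcol (inj₂ e) ≡ col (lo e) σ) →
                Separated (inj₁ (lo e)) (inj₂ e)
    from-spec (inj₁ hl≢l) =
      vertexColor (lo e) , inj₁ (inj₁ refl , [ ≢subdivision , [ ≢dart , hl≢l ]′ ]′ ∘ Class-subdivision⁻)
      where
      ≢subdivision : vcol (inj₂ e) ≢ vertexColor (lo e)
      ≢subdivision = SubdivisionColor.≢vertexˡ (spec e)
      ≢dart : dartColor (lo e) (hi e) ≢ vertexColor (lo e)
      ≢dart eq = lo≢hi e (sym (dartColor-injective (lo e) (trans eq (vertexColor≡dartColor (lo e)))))
    from-spec (inj₂ (σ , σ-unused , eq)) =
      vcol (inj₂ e) , inj₂ (subst (λ c → ¬ Class (inj₁ (lo e)) c) (sym eq) (unused∉Class σ-unused) , inj₁ refl)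

  separated-hi : ∀ e → Separated (inj₁ (hi e)) (inj₂ e)
  separated-hi e =
    vertexColor (hi e) , inj₁ (inj₁ refl , [ ≢subdivision , [ ≢dart-up , ≢dart-down ]′ ]′ ∘ Class-subdivision⁻)
    where
    ≢subdivision : vcol (inj₂ e) ≢ vertexColor (hi e)
    ≢subdivision = SubdivisionColor.≢vertexʳ (spec e)
    ≢dart-up : dartColor (lo e) (hi e) ≢ vertexColor (hi e)
    ≢dart-up eq =
      <⇒≢ (lo<hi e) (col-injective (hi e) (pos≤1+N (lo e)) (pos≤1+N (hi e)) (trans (sym (dartColor-up (lo<hi e))) eq))
    ≢dart-down : dartColor (hi e) (lo e) ≢ vertexColor (hi e)
    ≢dart-down eq = lo≢hi e (dartColor-injective (hi e) (trans eq (vertexColor≡dartColor (hi e))))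

  separated-subdivision : ∀ {u e} → Incident G u e → Separated (inj₁ u) (inj₂ e)
  separated-subdivision {u} {e} u∈e = by-end (incident-ends u∈e)
    where
    by-end : Ends u e → Separated (inj₁ u) (inj₂ e)
    by-end (inj₁ (u≡lo , _)) = subst (λ w → Separated (inj₁ w) (inj₂ e)) (sym u≡lo) (separated-lo e)
    by-end (inj₂ (u≡hi , _)) = subst (λ w → Separated (inj₁ w) (inj₂ e)) (sym u≡hi) (separated-hi e)

  module _ (hub : Fin N) (s : ℕ) (pos-hub : pos hub ≡ 0) (s+s≤N : s + s ≤ N)
           (hub-adj : ∀ v → s ≤ pos v → Adj G hub v) where

    private
      v≤u+N : ∀ u v → pos v ≤ pos u + N
      v≤u+N u v = ≤-trans (<⇒≤ (pos<N v)) (m≤n+m N (pos u))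

      offset<N : ∀ {u v} → pos u < pos v → pos u + N ∸ pos v < N
      offset<N {u} {v} u<v = subst (pos u + N ∸ pos v <_) (m+n∸m≡n (pos v) N) (∸-monoˡ-< (+-monoˡ-< N u<v) (v≤u+N u v))

    offset≢spare : ∀ {u v} → pos u < pos v → pos u + N ∸ pos v ≢ spare v
    offset≢spare {u} {v} u<v = by-half (s ≤? pos v)
      where
      t : ℕ
      t = pos u + N ∸ pos v
      by-half : Dec (s ≤ pos v) → t ≢ spare v
      by-half (yes s≤v) eq = <⇒≱ (m<n⇒0<n∸m (<-≤-trans (pos<N v) (m≤n+m N (pos u))))
        (subst₂ _≤_ (sym eq) pos-hub (nextLower-min hub<v z≤n))
        where
        hub<v : Lower v hub
        hub<v = hub-adj v s≤v , subst (_< pos v) (sym pos-hub) (≤-<-trans z≤n u<v)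
      by-half (no s≰v) eq with nextLower-sel v 0
      ... | inj₁ spare≡ = <⇒≢ (<-trans (offset<N u<v) (n<1+n N)) (trans eq spare≡)
      ... | inj₂ (y , (_ , y<v) , _ , spare≡) = <-asym v<t (subst (_< pos v) (sym (trans eq spare≡)) y<v)
        where
        v<s : pos v < s
        v<s = ≰⇒> s≰v
        v<t : pos v < t
        v<t = m+n≤o⇒m≤o∸n (suc (pos v)) (≤-trans (+-mono-≤ v<s (<⇒≤ v<s)) (≤-trans s+s≤N (m≤n+m N (pos u))))

    separated-original : ∀ {u v} → pos u < pos v → Separated (inj₁ u) (inj₁ v)
    separated-original {u} {v} u<v =
      col u N , inj₂ (unused∉Class (n≤1+n N , slot≢N u) , from-slot (slot-surjective v (offset<N u<v) (offset≢spare u<v)))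
      where
      from-slot : (∃ λ k → slot v k ≡ pos u + N ∸ pos v) → Class (inj₁ v) (col u N)
      from-slot (k , slot≡) = subst (Class (inj₁ v))
        (trans (cong (col v) slot≡) (col-shift u v (offset<N u<v) (m+[n∸m]≡n (v≤u+N u v))))
        (Class-original⁺ v k)

    separated : ∀ {x y} → CentralAdj G x y → Separated x y
    separated (nonadjacent {u} {v} u≢v _) with <-cmp (pos u) (pos v)
    ... | tri< u<v _ _ = separated-original u<v
    ... | tri≈ _ u≡v _ = ⊥-elim (u≢v (pos-injective u≡v))
    ... | tri> _ _ v<u = Separated-sym (separated-original v<u)
    separated (incident u∈e)  = separated-subdivision u∈e
    separated (incident′ u∈e) = Separated-sym (separated-subdivision u∈e)

    coloring : ℕTotalColoring (CentralAdj G) (Δ (central G) + 3)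
    coloring = record
      { vcol = vcol ; ecol = ecol ; vcol< = vcol< ; ecol< = ecol< ; ecol-sym = ecol-sym
      ; vproper = vproper ; eproper = eproper ; incproper = incproper ; separated = separated }

hub-central-AVD-TCC : ∀ {N} (G : Graph N) (π : Permutation′ N) (hub : Fin N) (s : ℕ) →
                      toℕ (π ⟨$⟩ʳ hub) ≡ 0 → s + s ≤ N → (∀ v → s ≤ toℕ (π ⟨$⟩ʳ v) → Adj G hub v) →
                      AVD-TCC (central G)
hub-central-AVD-TCC G π hub s pos-hub s+s≤N hub-adj =
  central-AVD-TCC G (OrderColoring.coloring G π hub s pos-hub s+s≤N hub-adj)

module _ {n} {H₁ H₂ : Graph n} (adj≗ : ∀ x y → adj H₁ x y ≡ adj H₂ x y) where

  Δ-cong : Δ H₁ ≡ Δ H₂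
  Δ-cong = cong (foldr _⊔_ 0) (map-cong deg-cong (allFin n))
    where
    deg-cong : ∀ x → deg H₁ x ≡ deg H₂ x
    deg-cong x = cong sum (map-cong (λ v → cong (if_then 1 else 0) (adj≗ x v)) (allFin n))

  AVDTotalColoring-cong : ∀ {k} → AVDTotalColoring H₁ k → AVDTotalColoring H₂ k
  AVDTotalColoring-cong {k} χ = record
    { vcol      = vcol
    ; ecol      = ecol
    ; ecol-sym  = λ u v u~v → ecol-sym u v (back u~v)
    ; vproper   = λ u v u~v → vproper u v (back u~v)
    ; eproper   = λ u v w u~v u~w → eproper u v w (back u~v) (back u~w)
    ; incproper = λ u v u~v → incproper u v (back u~v)
    ; avd       = λ u v u~v same → avd u v (back u~v) (λ c → mk⇔
                    (λ p → back-class (Equivalence.to (same c) (forth-class p)))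
                    (λ p → back-class (Equivalence.from (same c) (forth-class p))))
    }
    where
    open AVDTotalColoring χ
    back : ∀ {x y} → Adj H₂ x y → Adj H₁ x y
    back {x} {y} = trans (adj≗ x y)
    forth : ∀ {x y} → Adj H₁ x y → Adj H₂ x y
    forth {x} {y} = trans (sym (adj≗ x y))
    InClass₂ : Fin n → Fin k → Set
    InClass₂ u c = (vcol u ≡ c) ⊎ Σ (Fin n) (λ v → Adj H₂ u v × (ecol u v ≡ c))
    forth-class : ∀ {u c} → InClass u c → InClass₂ u c
    forth-class (inj₁ eq)              = inj₁ eq
    forth-class (inj₂ (v , u~v , eq)) = inj₂ (v , forth u~v , eq)
    back-class : ∀ {u c} → InClass₂ u c → InClass u c
    back-class (inj₁ eq)              = inj₁ eq
    back-class (inj₂ (v , u~v , eq)) = inj₂ (v , back u~v , eq)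

  AVD-TCC-cong : AVD-TCC H₁ → AVD-TCC H₂
  AVD-TCC-cong χ = subst (λ d → AVDTotalColoring H₂ (d + 3)) Δ-cong (AVDTotalColoring-cong χ)

-- C(G) depends on G only through adj G and edges G; the edge lists of graphs
-- with the same adjacency are only propositionally equal.
centralRelOn : ∀ {n} (a : Fin n → Fin n → Bool) (L : List (Fin n × Fin n)) →
               Fin n ⊎ Fin (length L) → Fin n ⊎ Fin (length L) → Bool
centralRelOn a L (inj₁ u) (inj₁ v) = not (a u v)
centralRelOn a L (inj₁ u) (inj₂ e) = endpoint u (lookup L e)
centralRelOn a L (inj₂ _) _        = false

centralOn : ∀ {n} (a : Fin n → Fin n → Bool) (L : List (Fin n × Fin n)) → Graph (n + length L)
centralOn {n} a L = mkGraph (λ x y → centralRelOn a L (splitAt n x) (splitAt n y))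

central≗centralOn : ∀ {n} (G : Graph n) x y → adj (central G) x y ≡ adj (centralOn (adj G) (edges G)) x y
central≗centralOn {n} G = mkGraph-cong (λ x y → same (splitAt n x) (splitAt n y))
  where
  same : ∀ a b → centralRel G a b ≡ centralRelOn (adj G) (edges G) a b
  same (inj₁ _) (inj₁ _) = refl
  same (inj₁ _) (inj₂ _) = refl
  same (inj₂ _) (inj₁ _) = refl
  same (inj₂ _) (inj₂ _) = refl

centralOn-cong : ∀ {n} {a a′ : Fin n → Fin n → Bool} {L} → (∀ u v → a u v ≡ a′ u v) →
                 ∀ x y → adj (centralOn a L) x y ≡ adj (centralOn a′ L) x y
centralOn-cong {n} {L = L} a≗a′ = mkGraph-cong (λ x y → same (splitAt n x) (splitAt n y))
  where
  same : ∀ b c → centralRelOn _ L b c ≡ centralRelOn _ L b c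
  same (inj₁ u) (inj₁ v) = cong not (a≗a′ u v)
  same (inj₁ _) (inj₂ _) = refl
  same (inj₂ _) _        = refl

edges-cong : ∀ {n} {G H : Graph n} → (∀ u v → adj G u v ≡ adj H u v) → edges G ≡ edges H
edges-cong {n} adj≗ = concatMap-cong (λ u → concatMap-cong (λ v →
  cong (λ b → if b ∧ (suc (toℕ u) ≤ᵇ toℕ v) then (u , v) ∷ [] else []) (adj≗ u v)) (allFin n)) (allFin n)

central-AVD-TCC-cong : ∀ {n} {G H : Graph n} → (∀ u v → adj G u v ≡ adj H u v) →
                       AVD-TCC (central G) → AVD-TCC (central H)
central-AVD-TCC-cong {G = G} {H} adj≗ χ =
  AVD-TCC-cong (λ x y → sym (central≗centralOn H x y))
    (subst (λ L → AVD-TCC (centralOn (adj H) L)) (edges-cong {G = G} {H} adj≗)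
      (AVD-TCC-cong {H₁ = centralOn (adj G) (edges G)} (centralOn-cong adj≗)
        (AVD-TCC-cong (central≗centralOn G) χ)))

adj-subst : ∀ {m n} (e : m ≡ n) (G : Graph m) → ∀ u v → adj (subst Graph e G) u v ≡ adj G (cast (sym e) u) (cast (sym e) v)
adj-subst refl G u v = sym (cong₂ (adj G) (cast-is-id refl u) (cast-is-id refl v))

central-AVD-TCC-subst : ∀ {m n} (e : m ≡ n) (G : Graph m) → AVD-TCC (central G) → AVD-TCC (central (subst Graph e G))
central-AVD-TCC-subst refl G χ = χ

-- Joins

central-join-emptyˡ : ∀ {n} (G₁ : Graph 0) (G₂ : Graph n) → AVD-TCC (central G₂) → AVD-TCC (central (join G₁ G₂))
central-join-emptyˡ G₁ G₂ = central-AVD-TCC-cong (λ u v → sym (mkGraph-induced G₂ (λ w → w) u v))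

central-join-emptyʳ : ∀ {n} (G₁ : Graph n) (G₂ : Graph 0) → AVD-TCC (central G₁) → AVD-TCC (central (join G₁ G₂))
central-join-emptyʳ {n} G₁ G₂ χ = central-AVD-TCC-cong adj≗ (central-AVD-TCC-subst n≡n+0 G₁ χ)
  where
  n≡n+0 : n ≡ n + 0
  n≡n+0 = sym (+-identityʳ n)
  left : Fin (n + 0) → Fin n
  left = cast (+-identityʳ n)
  splitAt-left : ∀ u → splitAt n u ≡ inj₁ (left u)
  splitAt-left u with splitAt n u in eq
  ... | inj₁ u′ = cong inj₁ (toℕ-injective (begin
    toℕ u′          ≡⟨ toℕ-↑ˡ u′ 0 ⟨
    toℕ (u′ ↑ˡ 0)   ≡⟨ cong (λ w → toℕ (Fin.join n 0 w)) eq ⟨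
    toℕ (Fin.join n 0 (splitAt n u)) ≡⟨ cong toℕ (join-splitAt n 0 u) ⟩
    toℕ u           ≡⟨ toℕ-cast _ u ⟨
    toℕ (left u)    ∎))
    where open ≡-Reasoning
  adj≗ : ∀ u v → adj (subst Graph n≡n+0 G₁) u v ≡ adj (join G₁ G₂) u v
  adj≗ u v = begin
    adj (subst Graph n≡n+0 G₁) u v ≡⟨ adj-subst n≡n+0 G₁ u v ⟩
    adj G₁ (left u) (left v)        ≡⟨ mkGraph-induced G₁ left u v ⟨
    adj (mkGraph (λ x y → adj G₁ (left x) (left y))) u v
      ≡⟨ mkGraph-cong (λ x y → cong₂ (joinRel G₁ G₂) (splitAt-left x) (splitAt-left y)) u v ⟨
    adj (join G₁ G₂) u v           ∎
    where open ≡-Reasoning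

join-cross : ∀ {n₁ n₂} (G₁ : Graph n₁) (G₂ : Graph n₂) {u v : Fin (n₁ + n₂)} →
             toℕ u < n₁ → n₁ ≤ toℕ v → Adj (join G₁ G₂) u v
join-cross {n₁} G₁ G₂ {u} {v} u<n₁ n₁≤v =
  Adj-mkGraph⁺ (λ x y → joinRel G₁ G₂ (splitAt n₁ x) (splitAt n₁ y))
    (λ u≡v → <⇒≱ u<n₁ (subst (λ w → n₁ ≤ toℕ w) (sym u≡v) n₁≤v))
    (inj₁ (cong₂ (joinRel G₁ G₂) (splitAt-< n₁ u u<n₁) (splitAt-≥ n₁ v n₁≤v)))

opposite-≥⇒< : ∀ {m n} (v : Fin (m + n)) → n ≤ toℕ (opposite v) → toℕ v < m
opposite-≥⇒< {m} {n} v n≤ = +-cancelˡ-≤ n (suc (toℕ v)) m (subst (n + suc (toℕ v) ≤_) (+-comm m n)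
  (m≤o∸n⇒m+n≤o n (toℕ<n v) (subst (n ≤_) (opposite-prop v) n≤)))

central-join-AVD-TCC : ∀ {n₁ n₂} (G₁ : Graph (suc n₁)) (G₂ : Graph (suc n₂)) → AVD-TCC (central (join G₁ G₂))
central-join-AVD-TCC {n₁} {n₂} G₁ G₂ with suc n₁ ≤? suc n₂
... | yes n₁≤n₂ = hub-central-AVD-TCC (join G₁ G₂) identity zero (suc n₁) refl (+-monoʳ-≤ (suc n₁) n₁≤n₂)
                    (λ v n₁≤v → join-cross G₁ G₂ (s≤s z≤n) n₁≤v)
-- In the reversed order G₂ comes first, and the last vertex is the hub.
... | no  n₁≰n₂ = hub-central-AVD-TCC (join G₁ G₂) reverse (opposite zero) (suc n₂) (cong toℕ (opposite-involutive zero))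
                    (+-monoˡ-≤ (suc n₂) (<⇒≤ (≰⇒> n₁≰n₂)))
                    (λ v n₂≤v → Adj-sym (join G₁ G₂) {v} (join-cross G₁ G₂ {v} (opposite-≥⇒< {suc n₁} v n₂≤v) hub≥n₁))
  where
  hub≥n₁ : suc n₁ ≤ toℕ (opposite {suc n₁ + suc n₂} zero)
  hub≥n₁ = subst (suc n₁ ≤_) (sym (trans (opposite-prop {suc n₁ + suc n₂} zero) (+-suc n₁ n₂)))
                  (s≤s (m≤m+n n₁ n₂))

edgeless : ∀ n → Graph n
edgeless n = mkGraph (λ _ _ → false)

Kbip≗join : ∀ m n x y → adj (Kbip m n) x y ≡ adj (join (edgeless m) (edgeless n)) x y
Kbip≗join m n = mkGraph-cong (λ x y → same (splitAt m x) (splitAt m y))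
  where
  same : ∀ a b → isLeft a ∧ not (isLeft b) ≡ joinRel (edgeless m) (edgeless n) a b
  same (inj₁ u) (inj₁ v) = sym (∧-zeroʳ _)
  same (inj₁ _) (inj₂ _) = refl
  same (inj₂ _) (inj₁ _) = refl
  same (inj₂ u) (inj₂ v) = sym (∧-zeroʳ _)

AVD-TCC-order-zero : (H : Graph 0) → AVD-TCC H
AVD-TCC-order-zero H = record
  { vcol = λ () ; ecol = λ () ; ecol-sym = λ () ; vproper = λ () ; eproper = λ () ; incproper = λ () ; avd = λ () }

proposition5p5 : (∀ {n₁ n₂} (G₁ : Graph n₁) (G₂ : Graph n₂) →
    AVD-TCC (central G₁) → AVD-TCC (central G₂) → AVD-TCC (central (join G₁ G₂)))
    × (∀ (m n : ℕ) → 2 ≤ m → 2 ≤ n → AVD-TCC (central (Kbip m n)))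
    × (∀ (F₁ F₂ : Family) (n : ℕ) → DefinedAt F₁ n → DefinedAt F₂ n →
    AVD-TCC (central (join (famGraph F₁ n) (famGraph F₂ n))))
    × (∀ (n : ℕ) (G₁ G₂ : Graph n) → AVD-TCC (central (join G₁ G₂)))
proposition5p5 = joins , complete-bipartite , families , equal-order
  where
  joins : ∀ {n₁ n₂} (G₁ : Graph n₁) (G₂ : Graph n₂) →
          AVD-TCC (central G₁) → AVD-TCC (central G₂) → AVD-TCC (central (join G₁ G₂))
  joins {zero}          G₁ G₂ _  χ₂ = central-join-emptyˡ G₁ G₂ χ₂
  joins {suc _} {zero}  G₁ G₂ χ₁ _  = central-join-emptyʳ G₁ G₂ χ₁
  joins {suc _} {suc _} G₁ G₂ _  _  = central-join-AVD-TCC G₁ G₂  -- hypotheses unused: both sides are non-empty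

  complete-bipartite : ∀ m n → 2 ≤ m → 2 ≤ n → AVD-TCC (central (Kbip m n))
  complete-bipartite (suc m) (suc n) _ _ =
    central-AVD-TCC-cong (λ x y → sym (Kbip≗join (suc m) (suc n) x y))
      (central-join-AVD-TCC (edgeless (suc m)) (edgeless (suc n)))

  equal-order : ∀ n (G₁ G₂ : Graph n) → AVD-TCC (central (join G₁ G₂))
  equal-order zero    G₁ G₂ = AVD-TCC-order-zero _
  equal-order (suc n) G₁ G₂ = central-join-AVD-TCC G₁ G₂

  families : ∀ F₁ F₂ n → DefinedAt F₁ n → DefinedAt F₂ n →
             AVD-TCC (central (join (famGraph F₁ n) (famGraph F₂ n)))
  families F₁ F₂ n _ _ = equal-order n (famGraph F₁ n) (famGraph F₂ n)
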